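{- Fix $n\in\mathbb{Z}_{\ge1}$ and $k\in\mathbb{Z}_{\ge0}$. Let $e_0\mid e_1\mid\cdots\mid e_r$ with $r\ge1$, $e_r=n$, $e_{r-1}=\gcd(n,k)$, set $e=e_0$, $d=e_1$, and $\mathcal{G}_D=\bigcap_{i=0}^{r-1}\mathcal{G}_{e_{i+1},e_i}$. Let $C_d$ (resp. $C_e$) act on $[0,n-1]$, and elementwise on subsets, by simultaneous rotation of $d$-intervals (resp. $e$-intervals), and let $C_e'$ be the unique subgroup of $C_d$ of order $e$. Then: (i) $\mathcal{G}_D=\coprod\mathcal{S}_\alpha$, a disjoint union over some subset of the weak compositions $\alpha=(\alpha_1,\dots,\alpha_{n/d})$ of $k$ satisfying $\gcd(d,\alpha_1,\dots,\alpha_{n/d})=e$; (ii) $\mathcal{G}_D$ is closed under the $C_d$- and $C_e$-actions; (iii) the $C_e'$- and $C_e$-actions on $\mathcal{G}_D$ are isomorphic; (iv) for every $C_d$-orbit $\mathcal{O}$ of $\mathcal{G}_D$, $\frac{d}{|\mathcal{O}|}\mid e$; (v) the statistic $\mathrm{Sum}'$ has period $e$ modulo $d$ on $\mathcal{G}_D$.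
   Context: $[a,b]=\{i\in\mathbb{Z}:a\le i\le b\}$. $\mathcal{S}$ is the set of $k$-element subsets of $[0,n-1]$. For $c\mid n$ and $j\in[1,n/c]$, $I_c^j=[(j-1)c,jc-1]$; simultaneous rotation of $c$-intervals is the permutation of $[0,n-1]$ sending $x\mapsto x+1$ for $x\in I_c^j$, $x\ne jc-1$, and $jc-1\mapsto(j-1)c$; it generates a cyclic group $C_c$ of order $c$. For $d\mid n$ and a weak composition $\alpha=(\alpha_1,\dots,\alpha_{n/d})$ of $k$, $\mathcal{S}_\alpha=\{A\in\mathcal{S}:\#(A\cap I_d^j)=\alpha_j\ \forall j\}$. For $f\mid c\mid n$, $\mathcal{G}_{c,f}=\{A\in\mathcal{S}:\gcd(c,\#(A\cap I_c^1),\dots,\#(A\cap I_c^{n/c}))=f\}$. $\mathrm{Sum}'(A)=\sum_{a\in A}a-\binom k2$. A statistic $\mathrm{stat}$ has period $a$ modulo $b$ on a set $W$ if $\#\{w\in W:\mathrm{stat}(w)\equiv i\ (\mathrm{mod}\ b)\}=\#\{w\in W:\mathrm{stat}(w)\equiv i+a\ (\mathrm{mod}\ b)\}$ for all $i$. Two group actions $(G,X),(G',X')$ are isomorphic if there are a group isomorphism $\phi:G\to G'$ and a bijection $\psi:X\to X'$ with $\psi(gx)=\phi(g)\psi(x)$. -}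

module Defs where

open import Data.Nat using (ℕ; zero; suc; _+_; _*_; _∸_; _<_; _≤_; _≟_)
open import Data.Nat.DivMod using (_/_; _%_)
open import Data.Nat.GCD using (gcd)
open import Data.Nat.Combinatorics using (_C_)
open import Data.Bool using (Bool; true; false; if_then_else_)
import Data.Bool as Bool
open import Data.Fin using (Fin; toℕ)
open import Data.Fin.Subset using (Subset; _∈_; ∣_∣)
open import Data.Fin.Subset.Properties using (_∈?_)
open import Data.Vec using (Vec; []; _∷_; tabulate)
open import Data.Vec.Properties using (≡-dec)
open import Data.List using (List; []; _∷_; _++_; map; filter; length; upTo; allFin; foldr; deduplicate)
open import Data.Nat.ListAction using (sum)
open import Data.List.Relation.Unary.All using (All; all?)
open import Data.Product using (_×_; Σ; ∃)
open import Relation.Nullary using (Dec)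
open import Relation.Nullary.Decidable using (_×-dec_)
open import Relation.Binary.PropositionalEquality using (_≡_)

-- Total versions of division / remainder (the divisor is never 0 in use,
-- since every e_i divides n ≥ 1).
quot : ℕ → ℕ → ℕ
quot m zero    = zero
quot m (suc c) = m / suc c

rem : ℕ → ℕ → ℕ
rem m zero    = m
rem m (suc c) = m % suc c

_≡_[mod_] : ℕ → ℕ → ℕ → Set
a ≡ b [mod m ] = rem a m ≡ rem b m

_≟S_ : ∀ {n} → (A B : Subset n) → Dec (A ≡ B)
_≟S_ = ≡-dec Bool._≟_

allSubsets : ∀ n → List (Subset n)
allSubsets zero    = [] ∷ []
allSubsets (suc n) = map (true ∷_) (allSubsets n) ++ map (false ∷_) (allSubsets n)

-- #(A ∩ I_c^{j+1}) : elements x ∈ A with ⌊x/c⌋ = j   (blocks indexed from 0)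
blockCount : ∀ {n} → ℕ → Subset n → ℕ → ℕ
blockCount {n} c A j =
  length (filter (λ x → (x ∈? A) ×-dec (quot (toℕ x) c ≟ j)) (allFin n))

blockCounts : ∀ {n} → ℕ → Subset n → List ℕ
blockCounts {n} c A = map (blockCount c A) (upTo (quot n c))

gcdBlocks : ∀ {n} → ℕ → Subset n → ℕ
gcdBlocks c A = foldr gcd c (blockCounts c A)

InS : ∀ {n} → ℕ → Subset n → Set
InS k A = ∣ A ∣ ≡ k

InG : ∀ {n} → ℕ → ℕ → ℕ → Subset n → Set
InG k c f A = InS k A × gcdBlocks c A ≡ f

-- A ∈ 𝒢_D = ⋂_{i=0}^{r-1} 𝒢_{e_{i+1}, e_i}   (plus A ∈ 𝒮, which covers r)
InGD : ∀ {n} → ℕ → ℕ → (ℕ → ℕ) → Subset n → Set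
InGD k r es A = InS k A × All (λ i → InG k (es (suc i)) (es i) A) (upTo r)

InGD? : ∀ {n} k r es (A : Subset n) → Dec (InGD k r es A)
InGD? k r es A = (∣ A ∣ ≟ k) ×-dec all? (λ i → (∣ A ∣ ≟ k) ×-dec (gcdBlocks (es (suc i)) A ≟ es i)) (upTo r)

InSα : ∀ {n} → ℕ → (d : ℕ) → Vec ℕ (quot n d) → Subset n → Set
InSα {n} k d α A = InS k A × (∀ (j : Fin (quot n d)) → blockCount d A (toℕ j) ≡ Data.Vec.lookup α j)

sumV : ∀ {m} → Vec ℕ m → ℕ
sumV []       = 0
sumV (x ∷ xs) = x + sumV xs

gcdV : ℕ → ∀ {m} → Vec ℕ m → ℕ
gcdV c []       = c
gcdV c (x ∷ xs) = gcd x (gcdV c xs)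

-- Simultaneous rotation of c-intervals: x ↦ x+1 inside a block, last ↦ first.
-- Its inverse on [0,n-1]:
rotInv : ℕ → ℕ → ℕ
rotInv c y = if Data.Nat._≡ᵇ_ (rem y c) 0 then y + c ∸ 1 else y ∸ 1

lookupℕ : ∀ {n} → Vec Bool n → ℕ → Bool
lookupℕ []       _       = false
lookupℕ (b ∷ _)  zero    = b
lookupℕ (_ ∷ bs) (suc i) = lookupℕ bs i

-- image of A under the rotation σ_c :  y ∈ σ_c A  ⇔  σ_c⁻¹ y ∈ A
rot : ∀ {n} → ℕ → Subset n → Subset n
rot c A = tabulate (λ y → lookupℕ A (rotInv c (toℕ y)))

rotPow : ∀ {n} → ℕ → ℕ → Subset n → Subset n
rotPow c zero    A = A
rotPow c (suc m) A = rot c (rotPow c m A)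

orbitSize : ∀ {n} → ℕ → Subset n → ℕ
orbitSize c A = length (deduplicate _≟S_ (map (λ m → rotPow c m A) (upTo c)))

-- Sum'(A) = Σ_{a∈A} a − binom(k,2)   (always ≥ 0, so truncated ∸ is exact)
Sum′ : ∀ {n} → ℕ → Subset n → ℕ
Sum′ {n} k A = sum (map toℕ (filter (_∈? A) (allFin n))) ∸ (k C 2)

countSum : ∀ n → ℕ → ℕ → (ℕ → ℕ) → ℕ → ℕ → ℕ
countSum n k r es b i =
  length (filter (λ A → InGD? k r es A ×-dec (rem (Sum′ k A) b ≟ rem i b)) (allSubsets n))

module Submission where

-- Every e_{i+1} is a multiple of d, so whether A ∈ 𝒢_D depends only on
-- #A and on the d-block counts #(A ∩ I_d^j).  Consequently 𝒢_D is a union of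
-- the classes 𝒮_α (part (i)) and is closed under every permutation of [0,n)
-- that maps each d-block into itself (BlockInvariant).  The remaining parts
-- use only this invariance and gcdBlocks d A = e:
--   (ii)  σ_d and σ_e are such permutations;
--   (iii) so is ρ, transposing inside each d-block the e × (d/e) grid of
--         e-blocks; it conjugates σ_e to σ_d^{d/e};
--   (iv)  if t is the least period of A under σ_d, then t ∣ d and A is
--         t-periodic inside each d-block, so d/t divides every d-block count;
--   (v)   so are the block shifts by Bézout coefficients c_b with
--         Σ_b c_b·#(A ∩ I_d^b) ≡ e (mod d); they raise Sum′ by e modulo d.

open import Defs
open import Data.Nat
open import Data.Nat.Properties
open import Data.Nat.DivMod
open import Data.Nat.Divisibility using (_∣_; divides; divides-refl; ∣-refl; ∣-trans; 0∣⇒≡0)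
open import Data.Nat.GCD using (gcd; gcd-GCD; gcd-greatest; module Bézout)
open import Data.Nat.Combinatorics using (_C_; nC1≡n; nCk+nC[k+1]≡[n+1]C[k+1])
open import Data.Nat.ListAction using (sum)
open import Data.Nat.ListAction.Properties using (sum-↭)
open import Data.Nat.Tactic.RingSolver using (solve-∀)
open import Data.Bool using (Bool; true; false; T; if_then_else_; _∧_)
open import Data.Fin using (Fin; toℕ; fromℕ<) renaming (zero to fzero; suc to fsuc)
open import Data.Fin.Properties using (toℕ-fromℕ<)
open import Data.Fin.Subset using (Subset; ∣_∣)
open import Data.Fin.Subset.Properties using (_∈?_)
open import Data.Vec using (Vec; []; _∷_; tabulate; lookup)
open import Data.Vec.Properties using (lookup∘tabulate)
import Data.List as List
open import Data.List using (List; []; _∷_; map; filter; length; applyUpTo; upTo; foldr; allFin; deduplicate)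
open import Data.List.Properties using (length-map; length-applyUpTo; map-applyUpTo)
open import Data.List.Membership.Propositional using (_∈_)
open import Data.List.Membership.Propositional.Properties
  using (∈-applyUpTo⁺; ∈-applyUpTo⁻; ∈-deduplicate⁺; ∈-deduplicate⁻; ∈-filter⁺; ∈-filter⁻; ∈-map⁺; ∈-map⁻; ∈-++⁺ˡ; ∈-++⁺ʳ)
open import Data.List.Membership.Propositional.Properties.WithK using (unique∧set⇒bag)
open import Data.List.Relation.Binary.BagAndSetEquality using (∼bag⇒↭)
open import Data.List.Relation.Binary.Permutation.Propositional using (_↭_)
open import Data.List.Relation.Binary.Permutation.Propositional.Properties using (↭-length; map⁺)
open import Data.List.Relation.Unary.All using (All; []; _∷_)
open import Data.List.Relation.Unary.All.Properties using (applyUpTo⁺₁)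
open import Data.List.Relation.Unary.AllPairs using ([]; _∷_)
open import Data.List.Relation.Unary.Any using (here)
open import Data.List.Relation.Unary.Unique.Propositional using (Unique)
import Data.List.Relation.Unary.Unique.Propositional.Properties as Unique
import Data.List.Relation.Unary.Unique.DecPropositional.Properties as DecUnique
open import Data.Product using (_×_; _,_; proj₁; proj₂; Σ; ∃; ∃-syntax)
open import Data.Sum using (_⊎_; inj₁; inj₂)
open import Data.Empty using (⊥; ⊥-elim)
open import Function using (_∘_)
open import Function.Bundles using (_⇔_; mk⇔)
open import Relation.Binary.PropositionalEquality
open import Relation.Binary.Definitions using (tri<; tri≈; tri>)
open import Relation.Nullary using (Dec; yes; no; ¬_; does)
open import Relation.Nullary.Decidable using (_×-dec_)
open import Relation.Unary using (Decidable)

-- All counting in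
-- this file (cardinalities, block counts, element sums) is expressed through
-- it, so that counting arguments become algebra of finite sums.
∑ : ℕ → (ℕ → ℕ) → ℕ
∑ zero    f = 0
∑ (suc m) f = f 0 + ∑ m (f ∘ suc)

∑-cong : ∀ m {f g : ℕ → ℕ} → (∀ x → x < m → f x ≡ g x) → ∑ m f ≡ ∑ m g
∑-cong zero    eq = refl
∑-cong (suc m) eq = cong₂ _+_ (eq 0 z<s) (∑-cong m (λ x x<m → eq (suc x) (s<s x<m)))

∑-zero : ∀ m {f : ℕ → ℕ} → (∀ x → x < m → f x ≡ 0) → ∑ m f ≡ 0
∑-zero m {f} eq = trans (∑-cong m eq) (∑-const0 m)
  where
  ∑-const0 : ∀ m → ∑ m (λ _ → 0) ≡ 0
  ∑-const0 zero    = refl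
  ∑-const0 (suc m) = ∑-const0 m

∑-const : ∀ m c → ∑ m (λ _ → c) ≡ m * c
∑-const zero    c = refl
∑-const (suc m) c = cong (c +_) (∑-const m c)

∑-+ : ∀ m (f g : ℕ → ℕ) → ∑ m (λ x → f x + g x) ≡ ∑ m f + ∑ m g
∑-+ zero    f g = refl
∑-+ (suc m) f g = begin
  f 0 + g 0 + ∑ m (λ x → f (suc x) + g (suc x)) ≡⟨ cong (f 0 + g 0 +_) (∑-+ m (f ∘ suc) (g ∘ suc)) ⟩
  f 0 + g 0 + (∑ m (f ∘ suc) + ∑ m (g ∘ suc))   ≡⟨ +-assoc-swap (f 0) (g 0) _ _ ⟩
  f 0 + ∑ m (f ∘ suc) + (g 0 + ∑ m (g ∘ suc))   ∎
  where
  open ≡-Reasoning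
  +-assoc-swap : ∀ a b c d → a + b + (c + d) ≡ a + c + (b + d)
  +-assoc-swap = solve-∀

∑-*ˡ : ∀ m c (f : ℕ → ℕ) → ∑ m (λ x → c * f x) ≡ c * ∑ m f
∑-*ˡ zero    c f = sym (*-zeroʳ c)
∑-*ˡ (suc m) c f = trans (cong (c * f 0 +_) (∑-*ˡ m c (f ∘ suc))) (sym (*-distribˡ-+ c (f 0) _))

∑-*ʳ : ∀ m c (f : ℕ → ℕ) → ∑ m (λ x → f x * c) ≡ ∑ m f * c
∑-*ʳ m c f = trans (∑-cong m (λ x _ → *-comm (f x) c)) (trans (∑-*ˡ m c f) (*-comm c _))

∑-split : ∀ a b (f : ℕ → ℕ) → ∑ (a + b) f ≡ ∑ a f + ∑ b (λ x → f (a + x))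
∑-split zero    b f = refl
∑-split (suc a) b f = trans (cong (f 0 +_) (∑-split a b (f ∘ suc))) (sym (+-assoc (f 0) _ _))

∑-swap : ∀ a b (f : ℕ → ℕ → ℕ) → ∑ a (λ i → ∑ b (f i)) ≡ ∑ b (λ j → ∑ a (λ i → f i j))
∑-swap zero    b f = sym (∑-zero b (λ _ _ → refl))
∑-swap (suc a) b f = trans (cong (∑ b (f 0) +_) (∑-swap a b (f ∘ suc)))
                           (sym (∑-+ b (f 0) (λ j → ∑ a (λ i → f (suc i) j))))

∑-blocks : ∀ q t (g : ℕ → ℕ) → ∑ (q * t) g ≡ ∑ q (λ v → ∑ t (λ u → g (v * t + u)))
∑-blocks zero    t g = refl
∑-blocks (suc q) t g = begin
  ∑ (t + q * t) g                                        ≡⟨ ∑-split t (q * t) g ⟩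
  ∑ t g + ∑ (q * t) (λ x → g (t + x))                    ≡⟨ cong (∑ t g +_) (∑-blocks q t (λ x → g (t + x))) ⟩
  ∑ t g + ∑ q (λ v → ∑ t (λ u → g (t + (v * t + u))))   ≡⟨ cong (∑ t g +_) (∑-cong q (λ v _ → ∑-cong t (λ u _ →
                                                              cong g (sym (+-assoc t (v * t) u))))) ⟩
  ∑ t g + ∑ q (λ v → ∑ t (λ u → g (suc v * t + u)))     ∎
  where open ≡-Reasoning

δ : ℕ → ℕ → ℕ
δ a b = if a ≡ᵇ b then 1 else 0

δ-refl : ∀ a → δ a a ≡ 1
δ-refl a with a ≡ᵇ a | ≡⇒≡ᵇ a a refl
... | true | _ = refl

δ-≢ : ∀ {a b} → a ≢ b → δ a b ≡ 0
δ-≢ {a} {b} a≢b with a ≡ᵇ b in eq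
... | true  = ⊥-elim (a≢b (≡ᵇ⇒≡ a b (subst T (sym eq) _)))
... | false = refl

δ-sym : ∀ a b → δ a b ≡ δ b a
δ-sym a b with a ≟ b
... | yes refl = refl
... | no a≢b   = trans (δ-≢ a≢b) (sym (δ-≢ (a≢b ∘ sym)))

∑-δ : ∀ m j (f : ℕ → ℕ) → j < m → ∑ m (λ x → f x * δ j x) ≡ f j
∑-δ (suc m) zero f _ = begin
  f 0 * δ 0 0 + ∑ m (λ x → f (suc x) * δ 0 (suc x)) ≡⟨ cong₂ _+_ (trans (cong (f 0 *_) (δ-refl 0)) (*-identityʳ (f 0)))
                                                          (∑-zero m (λ x _ → trans (cong (f (suc x) *_) (δ-≢ {0} {suc x} 0≢1+n)) (*-zeroʳ (f (suc x))))) ⟩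
  f 0 + 0                                            ≡⟨ +-identityʳ (f 0) ⟩
  f 0                                                ∎
  where open ≡-Reasoning
∑-δ (suc m) (suc j) f (s<s j<m) = begin
  f 0 * δ (suc j) 0 + ∑ m (λ x → f (suc x) * δ j x) ≡⟨ cong (_+ ∑ m (λ x → f (suc x) * δ j x))
                                                          (trans (cong (f 0 *_) (δ-≢ {suc j} {0} (0≢1+n ∘ sym))) (*-zeroʳ (f 0))) ⟩
  ∑ m (λ x → f (suc x) * δ j x)                      ≡⟨ ∑-δ m j (f ∘ suc) j<m ⟩
  f (suc j)                                          ∎
  where open ≡-Reasoning

∑-δ-one : ∀ m j → j < m → ∑ m (δ j) ≡ 1
∑-δ-one m j j<m = trans (∑-cong m (λ x _ → sym (*-identityˡ (δ j x)))) (∑-δ m j (λ _ → 1) j<m)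

div-of-block : ∀ c j t → t < suc c → (j * suc c + t) / suc c ≡ j
div-of-block c j t t<c = begin
  (j * suc c + t) / suc c        ≡⟨ +-distrib-/-∣ˡ t (divides-refl j) ⟩
  j * suc c / suc c + t / suc c  ≡⟨ cong₂ _+_ (m*n/n≡m j (suc c)) (m<n⇒m/n≡0 t<c) ⟩
  j + 0                          ≡⟨ +-identityʳ j ⟩
  j                              ∎
  where open ≡-Reasoning

mod-of-block : ∀ c j t → t < suc c → (j * suc c + t) % suc c ≡ t
mod-of-block c j t t<c = begin
  (j * suc c + t) % suc c  ≡⟨ cong (_% suc c) (+-comm (j * suc c) t) ⟩
  (t + j * suc c) % suc c  ≡⟨ [m+kn]%n≡m%n t j (suc c) ⟩
  t % suc c                ≡⟨ m<n⇒m%n≡m t<c ⟩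
  t                        ∎
  where open ≡-Reasoning

div-mod-eq : ∀ c y → y ≡ (y / suc c) * suc c + y % suc c
div-mod-eq c y = trans (m≡m%n+[m/n]*n y (suc c)) (+-comm (y % suc c) _)

grid-< : ∀ {a b e h} → a < e → b < h → a * h + b < e * h
grid-< {a} {b} {e} {h} a<e b<h = begin-strict
  a * h + b  <⟨ +-monoʳ-< (a * h) b<h ⟩
  a * h + h  ≡⟨ +-comm (a * h) h ⟩
  suc a * h  ≤⟨ *-monoˡ-≤ h a<e ⟩
  e * h      ∎
  where open ≤-Reasoning

δ-split : ∀ c y j t → t < suc c → δ y (j * suc c + t) ≡ δ (y / suc c) j * δ (y % suc c) t
δ-split c y j t t<c with y ≟ j * suc c + t
... | yes refl rewrite δ-refl (j * suc c + t) | div-of-block c j t t<c | mod-of-block c j t t<c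
                     | δ-refl j | δ-refl t = refl
... | no y≢ rewrite δ-≢ y≢ with y / suc c ≟ j | y % suc c ≟ t
...   | yes refl | yes refl = ⊥-elim (y≢ (div-mod-eq c y))
...   | yes _    | no r≢    rewrite δ-≢ r≢ = sym (*-zeroʳ (δ (y / suc c) j))
...   | no q≢    | _        rewrite δ-≢ q≢ = refl

δ-div : ∀ c y j → δ (y / suc c) j ≡ ∑ (suc c) (λ t → δ y (j * suc c + t))
δ-div c y j = sym (begin
  ∑ (suc c) (λ t → δ y (j * suc c + t))           ≡⟨ ∑-cong (suc c) (λ t t<c → δ-split c y j t t<c) ⟩
  ∑ (suc c) (λ t → δ (y / suc c) j * δ (y % suc c) t) ≡⟨ ∑-*ˡ (suc c) (δ (y / suc c) j) (δ (y % suc c)) ⟩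
  δ (y / suc c) j * ∑ (suc c) (δ (y % suc c))     ≡⟨ cong (δ (y / suc c) j *_) (∑-δ-one (suc c) _ (m%n<n y (suc c))) ⟩
  δ (y / suc c) j * 1                             ≡⟨ *-identityʳ _ ⟩
  δ (y / suc c) j                                 ∎)
  where open ≡-Reasoning

record Perm (n : ℕ) (π : ℕ → ℕ) : Set where
  field
    inv  : ℕ → ℕ
    π<   : ∀ x → x < n → π x < n
    inv< : ∀ x → x < n → inv x < n
    invπ : ∀ x → x < n → inv (π x) ≡ x
    πinv : ∀ x → x < n → π (inv x) ≡ x

unique-same-elements⇒↭ : ∀ {a} {A : Set a} {xs ys : List A} → Unique xs → Unique ys
  → (∀ {x} → x ∈ xs → x ∈ ys) → (∀ {x} → x ∈ ys → x ∈ xs) → xs ↭ ys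
unique-same-elements⇒↭ ux uy f g = ∼bag⇒↭ (unique∧set⇒bag ux uy (mk⇔ f g))

unique-applyUpTo : ∀ {a} {A : Set a} m (g : ℕ → A)
  → (∀ i j → i < m → j < m → g i ≡ g j → i ≡ j) → Unique (applyUpTo g m)
unique-applyUpTo zero    g inj = []
unique-applyUpTo (suc m) g inj =
  applyUpTo⁺₁ (g ∘ suc) m (λ i<m eq → 0≢1+n (inj 0 _ z<s (s<s i<m) eq))
  ∷ unique-applyUpTo m (g ∘ suc) (λ i j i<m j<m eq → suc-injective (inj (suc i) (suc j) (s<s i<m) (s<s j<m) eq))

∑-as-sum : ∀ m (f g : ℕ → ℕ) → ∑ m (f ∘ g) ≡ sum (map f (applyUpTo g m))
∑-as-sum zero    f g = refl
∑-as-sum (suc m) f g = cong (f (g 0) +_) (∑-as-sum m f (g ∘ suc))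

∑-perm : ∀ {n π} → Perm n π → ∀ (f : ℕ → ℕ) → ∑ n (f ∘ π) ≡ ∑ n f
∑-perm {n} {π} P f = begin
  ∑ n (f ∘ π)                      ≡⟨ ∑-as-sum n f π ⟩
  sum (map f (applyUpTo π n))      ≡⟨ sum-↭ (map⁺ f images↭range) ⟩
  sum (map f (applyUpTo (λ x → x) n)) ≡⟨ sym (∑-as-sum n f (λ x → x)) ⟩
  ∑ n f                            ∎
  where
  open ≡-Reasoning
  open Perm P
  image∈range : ∀ {x} → x ∈ applyUpTo π n → x ∈ applyUpTo (λ x → x) n
  image∈range x∈ with ∈-applyUpTo⁻ π x∈
  ... | i , i<n , refl = ∈-applyUpTo⁺ (λ x → x) (π< i i<n)
  range∈image : ∀ {x} → x ∈ applyUpTo (λ x → x) n → x ∈ applyUpTo π n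
  range∈image x∈ with ∈-applyUpTo⁻ (λ x → x) x∈
  ... | i , i<n , refl = subst (_∈ applyUpTo π n) (πinv i i<n) (∈-applyUpTo⁺ π (inv< i i<n))
  images↭range : applyUpTo π n ↭ applyUpTo (λ x → x) n
  images↭range = unique-same-elements⇒↭
    (unique-applyUpTo n π (λ i j i<n j<n eq → trans (sym (invπ i i<n)) (trans (cong inv eq) (invπ j j<n))))
    (unique-applyUpTo n (λ x → x) (λ _ _ _ _ eq → eq))
    image∈range range∈image

Perm-ext : ∀ {n π σ} → (∀ x → x < n → π x ≡ σ x) → Perm n π → Perm n σ
Perm-ext {n} eq P = record
  { inv  = inv
  ; π<   = λ x x<n → subst (_< n) (eq x x<n) (π< x x<n)
  ; inv< = inv<
  ; invπ = λ x x<n → trans (cong inv (sym (eq x x<n))) (invπ x x<n)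
  ; πinv = λ x x<n → trans (sym (eq (inv x) (inv< x x<n))) (πinv x x<n)
  }
  where open Perm P

Perm-inverse : ∀ {n π} (P : Perm n π) → Perm n (Perm.inv P)
Perm-inverse {π = π} P = record
  { inv = π ; π< = inv< ; inv< = π< ; invπ = πinv ; πinv = invπ }
  where open Perm P

-- A subset A of [0,n) is read through its indicator  χ A : ℕ → ℕ
-- (0 outside [0,n)); cardinality, block counts and the element sum are
-- then finite sums over [0,n).
bit : Bool → ℕ
bit true  = 1
bit false = 0

χ : ∀ {n} → Subset n → ℕ → ℕ
χ A x = bit (lookupℕ A x)

lookupℕ-tabulate : ∀ {n} (g : Fin n → Bool) y (y<n : y < n) → lookupℕ (tabulate g) y ≡ g (fromℕ< y<n)
lookupℕ-tabulate {suc n} g zero    y<n       = refl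
lookupℕ-tabulate {suc n} g (suc y) (s<s y<n) = lookupℕ-tabulate (g ∘ fsuc) y y<n

subset-ext : ∀ {n} (A B : Subset n) → (∀ y → y < n → lookupℕ A y ≡ lookupℕ B y) → A ≡ B
subset-ext []      []      eq = refl
subset-ext (a ∷ A) (b ∷ B) eq = cong₂ _∷_ (eq 0 z<s) (subset-ext A B (λ y y<n → eq (suc y) (s<s y<n)))

card-∑ : ∀ {n} (A : Subset n) → ∣ A ∣ ≡ ∑ n (χ A)
card-∑ []          = refl
card-∑ (true ∷ A)  = cong suc (card-∑ A)
card-∑ (false ∷ A) = card-∑ A

does-∈ : ∀ {n} (x : Fin n) (A : Subset n) → does (x ∈? A) ≡ lookupℕ A (toℕ x)
does-∈ fzero    (true ∷ A)  = refl
does-∈ fzero    (false ∷ A) = refl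
does-∈ (fsuc x) (a ∷ A) with x ∈? A | does-∈ x A
... | yes _ | eq = eq
... | no  _ | eq = eq

length-filter-∑ : ∀ {n} {P : Fin n → Set} (P? : Decidable P) (g : ℕ → ℕ)
  → (∀ i → bit (does (P? i)) ≡ g (toℕ i)) → length (filter P? (allFin n)) ≡ ∑ n g
length-filter-∑ = go (λ i → i)
  where
  go : ∀ {N n} {P : Fin N → Set} (f : Fin n → Fin N) (P? : Decidable P) (g : ℕ → ℕ)
     → (∀ i → bit (does (P? (f i))) ≡ g (toℕ i)) → length (filter P? (List.tabulate f)) ≡ ∑ n g
  go {n = zero}  f P? g eq = refl
  go {n = suc n} f P? g eq with does (P? (f fzero)) | eq fzero
  ... | true  | e = trans (cong suc (go (f ∘ fsuc) P? (g ∘ suc) (eq ∘ fsuc))) (cong (_+ ∑ n (g ∘ suc)) e)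
  ... | false | e = trans (go (f ∘ fsuc) P? (g ∘ suc) (eq ∘ fsuc)) (cong (_+ ∑ n (g ∘ suc)) e)

sum-filter-∑ : ∀ {n} {P : Fin n → Set} (P? : Decidable P) (g : ℕ → ℕ)
  → (∀ i → bit (does (P? i)) * toℕ i ≡ g (toℕ i)) → sum (map toℕ (filter P? (allFin n))) ≡ ∑ n g
sum-filter-∑ = go (λ i → i)
  where
  go : ∀ {N n} {P : Fin N → Set} (f : Fin n → Fin N) (P? : Decidable P) (g : ℕ → ℕ)
     → (∀ i → bit (does (P? (f i))) * toℕ (f i) ≡ g (toℕ i))
     → sum (map toℕ (filter P? (List.tabulate f))) ≡ ∑ n g
  go {n = zero}  f P? g eq = refl
  go {n = suc n} f P? g eq with does (P? (f fzero)) | eq fzero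
  ... | true  | e = cong₂ _+_ (trans (sym (+-identityʳ _)) e) (go (f ∘ fsuc) P? (g ∘ suc) (eq ∘ fsuc))
  ... | false | e = trans (go (f ∘ fsuc) P? (g ∘ suc) (eq ∘ fsuc)) (cong (_+ ∑ n (g ∘ suc)) e)

bit-∧ : ∀ a b → bit (a ∧ b) ≡ bit a * bit b
bit-∧ true  b = sym (+-identityʳ _)
bit-∧ false b = refl

bit-≟ : ∀ a b → bit (does (a ≟ b)) ≡ δ a b
bit-≟ a b with a ≡ᵇ b
... | true  = refl
... | false = refl

blockSum : ∀ {n} → ℕ → Subset n → ℕ → ℕ
blockSum {n} c A j = ∑ n (λ x → χ A x * δ (quot x c) j)

blockCount≡blockSum : ∀ {n} c (A : Subset n) j → blockCount c A j ≡ blockSum c A j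
blockCount≡blockSum c A j = length-filter-∑ _ _ λ i →
  trans (bit-∧ (does (i ∈? A)) _) (cong₂ _*_ (cong bit (does-∈ i A)) (bit-≟ (quot (toℕ i) c) j))

elemSum : ∀ {n} → Subset n → ℕ
elemSum {n} A = ∑ n (λ x → χ A x * x)

elemSum-∑ : ∀ {n} (A : Subset n) → sum (map toℕ (filter (_∈? A) (allFin n))) ≡ elemSum A
elemSum-∑ A = sum-filter-∑ _ _ λ i → cong (λ b → bit b * toℕ i) (does-∈ i A)

-- The pullback  {y | π y ∈ A}  of A along π; for a permutation π it is the
-- image of A under π⁻¹.  By definition  rot c A = pullback (rotInv c) A.
pullback : ∀ {n} → (ℕ → ℕ) → Subset n → Subset n
pullback π A = tabulate (λ y → lookupℕ A (π (toℕ y)))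

lookup-pullback : ∀ {n} π (A : Subset n) y → y < n → lookupℕ (pullback π A) y ≡ lookupℕ A (π y)
lookup-pullback π A y y<n = trans (lookupℕ-tabulate _ y y<n) (cong (λ z → lookupℕ A (π z)) (toℕ-fromℕ< y<n))

pullback-inverse : ∀ {n π} (P : Perm n π) (A : Subset n) → pullback (Perm.inv P) (pullback π A) ≡ A
pullback-inverse {n} {π} P A = subset-ext _ _ λ y y<n → begin
  lookupℕ (pullback inv (pullback π A)) y ≡⟨ lookup-pullback inv (pullback π A) y y<n ⟩
  lookupℕ (pullback π A) (inv y)          ≡⟨ lookup-pullback π A (inv y) (inv< y y<n) ⟩
  lookupℕ A (π (inv y))                   ≡⟨ cong (lookupℕ A) (πinv y y<n) ⟩
  lookupℕ A y                             ∎
  where open ≡-Reasoning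
        open Perm P

card-pullback : ∀ {n π} → Perm n π → (A : Subset n) → ∣ pullback π A ∣ ≡ ∣ A ∣
card-pullback {n} {π} P A = begin
  ∣ pullback π A ∣        ≡⟨ card-∑ (pullback π A) ⟩
  ∑ n (χ (pullback π A))  ≡⟨ ∑-cong n (λ y y<n → cong bit (lookup-pullback π A y y<n)) ⟩
  ∑ n (χ A ∘ π)           ≡⟨ ∑-perm P (χ A) ⟩
  ∑ n (χ A)               ≡⟨ sym (card-∑ A) ⟩
  ∣ A ∣                   ∎
  where open ≡-Reasoning

blockSum-pullback : ∀ {n π} → Perm n π → ∀ c → (∀ x → x < n → quot (π x) c ≡ quot x c)
  → (A : Subset n) → ∀ j → blockSum c (pullback π A) j ≡ blockSum c A j
blockSum-pullback {n} {π} P c inBlock A j = begin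
  ∑ n (λ y → χ (pullback π A) y * δ (quot y c) j) ≡⟨ ∑-cong n (λ y y<n → cong₂ _*_ (cong bit (lookup-pullback π A y y<n))
                                                        (cong (λ z → δ z j) (sym (inBlock y y<n)))) ⟩
  ∑ n ((λ x → χ A x * δ (quot x c) j) ∘ π)        ≡⟨ ∑-perm P (λ x → χ A x * δ (quot x c) j) ⟩
  ∑ n (λ x → χ A x * δ (quot x c) j)              ∎
  where open ≡-Reasoning

elemSum-pullback : ∀ {n π} (P : Perm n π) (A : Subset n) → elemSum (pullback π A) ≡ ∑ n (λ x → χ A x * Perm.inv P x)
elemSum-pullback {n} {π} P A = begin
  ∑ n (λ y → χ (pullback π A) y * y)  ≡⟨ ∑-cong n (λ y y<n → cong₂ _*_ (cong bit (lookup-pullback π A y y<n)) (sym (invπ y y<n))) ⟩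
  ∑ n ((λ x → χ A x * inv x) ∘ π)     ≡⟨ ∑-perm P (λ x → χ A x * inv x) ⟩
  ∑ n (λ x → χ A x * inv x)           ∎
  where open ≡-Reasoning
        open Perm P

divisor-pos : ∀ {c n} → c ∣ n → 1 ≤ n → 1 ≤ c
divisor-pos {zero}  c∣n 1≤n = ⊥-elim (<⇒≢ 1≤n (sym (0∣⇒≡0 c∣n)))
divisor-pos {suc c} _   _   = s≤s z≤n

same-block-coarsen : ∀ {c D} → c ∣ D → 1 ≤ D → ∀ x y → quot x c ≡ quot y c → quot x D ≡ quot y D
same-block-coarsen {c} c∣D 1≤D x y eq with divisor-pos c∣D 1≤D | c∣D
... | s≤s _ | divides zero    refl = ⊥-elim (<-irrefl refl 1≤D)
... | s≤s _ | divides (suc q) refl = begin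
  quot x (suc q * c)  ≡⟨ cong (quot x) (*-comm (suc q) c) ⟩
  quot x (c * suc q)  ≡⟨ sym (m/n/o≡m/[n*o] x c (suc q)) ⟩
  x / c / suc q       ≡⟨ cong (_/ suc q) eq ⟩
  y / c / suc q       ≡⟨ m/n/o≡m/[n*o] y c (suc q) ⟩
  quot y (c * suc q)  ≡⟨ cong (quot y) (*-comm c (suc q)) ⟩
  quot y (suc q * c)  ∎
  where open ≡-Reasoning

-- All the maps of [0,n) in this file
-- (rotations, the interleaving ρ of part (iii), the shifts of part (v)) are
-- of this form.
blockMap : ℕ → (ℕ → ℕ → ℕ) → ℕ → ℕ
blockMap c τ x = (x / suc c) * suc c + τ (x / suc c) (x % suc c)

blockMap-at : ∀ c τ b u → u < suc c → blockMap c τ (b * suc c + u) ≡ b * suc c + τ b u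
blockMap-at c τ b u u<c rewrite div-of-block c b u u<c | mod-of-block c b u u<c = refl

blockMap-block : ∀ c τ x → τ (x / suc c) (x % suc c) < suc c → blockMap c τ x / suc c ≡ x / suc c
blockMap-block c τ x τ< = div-of-block c (x / suc c) _ τ<

blockMap-∘ : ∀ c τ₁ τ₂ x → τ₁ (x / suc c) (x % suc c) < suc c
  → blockMap c τ₂ (blockMap c τ₁ x) ≡ blockMap c (λ b t → τ₂ b (τ₁ b t)) x
blockMap-∘ c τ₁ τ₂ x τ₁< rewrite div-of-block c (x / suc c) _ τ₁< | mod-of-block c (x / suc c) _ τ₁< = refl

blockMap-id : ∀ c τ x → τ (x / suc c) (x % suc c) ≡ x % suc c → blockMap c τ x ≡ x
blockMap-id c τ x eq rewrite eq = sym (div-mod-eq c x)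

blockMap-cong : ∀ c {τ τ′ : ℕ → ℕ → ℕ} → (∀ b t → t < suc c → τ b t ≡ τ′ b t) → ∀ x → blockMap c τ x ≡ blockMap c τ′ x
blockMap-cong c eq x = cong ((x / suc c) * suc c +_) (eq _ _ (m%n<n x (suc c)))

blockMap-< : ∀ c m τ x → x < m * suc c → τ (x / suc c) (x % suc c) < suc c → blockMap c τ x < m * suc c
blockMap-< c m τ x x<n τ< = grid-< (m<n*o⇒m/o<n {x} {m} {suc c} x<n) τ<

blockMap-Perm : ∀ c m (τ τ′ : ℕ → ℕ → ℕ)
  → (∀ b t → t < suc c → τ b t < suc c) → (∀ b t → t < suc c → τ′ b t < suc c)
  → (∀ b t → t < suc c → τ′ b (τ b t) ≡ t) → (∀ b t → t < suc c → τ b (τ′ b t) ≡ t)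
  → Perm (m * suc c) (blockMap c τ)
blockMap-Perm c m τ τ′ τ< τ′< τ′τ ττ′ = record
  { inv  = blockMap c τ′
  ; π<   = λ x x<n → blockMap-< c m τ x x<n (τ< _ _ (rem< x))
  ; inv< = λ x x<n → blockMap-< c m τ′ x x<n (τ′< _ _ (rem< x))
  ; invπ = λ x _ → trans (blockMap-∘ c τ τ′ x (τ< _ _ (rem< x))) (blockMap-id c (λ b t → τ′ b (τ b t)) x (τ′τ _ _ (rem< x)))
  ; πinv = λ x _ → trans (blockMap-∘ c τ′ τ x (τ′< _ _ (rem< x))) (blockMap-id c (λ b t → τ b (τ′ b t)) x (ττ′ _ _ (rem< x)))
  }
  where rem< : ∀ x → x % suc c < suc c
        rem< x = m%n<n x (suc c)

shift : ℕ → ℕ → ℕ → ℕ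
shift c a t = (t + a) % suc c

shift-< : ∀ c a t → shift c a t < suc c
shift-< c a t = m%n<n (t + a) (suc c)

shift-∘ : ∀ c a a′ t → shift c a′ (shift c a t) ≡ shift c (a + a′) t
shift-∘ c a a′ t = begin
  ((t + a) % suc c + a′) % suc c                 ≡⟨ %-distribˡ-+ ((t + a) % suc c) a′ (suc c) ⟩
  ((t + a) % suc c % suc c + a′ % suc c) % suc c ≡⟨ cong (λ z → (z + a′ % suc c) % suc c) (m%n%n≡m%n (t + a) (suc c)) ⟩
  ((t + a) % suc c + a′ % suc c) % suc c         ≡⟨ sym (%-distribˡ-+ (t + a) a′ (suc c)) ⟩
  (t + a + a′) % suc c                           ≡⟨ cong (_% suc c) (+-assoc t a a′) ⟩
  (t + (a + a′)) % suc c                         ∎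
  where open ≡-Reasoning

shift-multiple : ∀ c k t → t < suc c → shift c (k * suc c) t ≡ t
shift-multiple c k t t<c = trans ([m+kn]%n≡m%n t k (suc c)) (m<n⇒m%n≡m t<c)

-- Shifts by a and by c·a ≡ -a (mod c+1) are mutually inverse.
shift-inverse : ∀ c a t → t < suc c → shift c (c * a) (shift c a t) ≡ t
shift-inverse c a t t<c = begin
  shift c (c * a) (shift c a t) ≡⟨ shift-∘ c a (c * a) t ⟩
  shift c (a + c * a) t         ≡⟨ cong (λ z → shift c z t) (reassoc a c) ⟩
  shift c (a * suc c) t         ≡⟨ shift-multiple c a t t<c ⟩
  t                             ∎
  where
  open ≡-Reasoning
  reassoc : ∀ a c → a + c * a ≡ a * suc c
  reassoc = solve-∀

shift-inverseʳ : ∀ c a t → t < suc c → shift c a (shift c (c * a) t) ≡ t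
shift-inverseʳ c a t t<c = trans (shift-∘ c (c * a) a t)
  (trans (cong (λ z → shift c z t) (+-comm (c * a) a)) (trans (sym (shift-∘ c a (c * a) t)) (shift-inverse c a t t<c)))

iter : ℕ → (ℕ → ℕ) → ℕ → ℕ
iter zero    f y = y
iter (suc m) f y = iter m f (f y)

iter-+ : ∀ a b f y → iter (a + b) f y ≡ iter b f (iter a f y)
iter-+ zero    b f y = refl
iter-+ (suc a) b f y = iter-+ a b f (f y)

iter-cong : ∀ m {f g} → (∀ x → f x ≡ g x) → ∀ y → iter m f y ≡ iter m g y
iter-cong zero    eq y = refl
iter-cong (suc m) {f} {g} eq y = trans (cong (iter m f) (eq y)) (iter-cong m eq (g y))

iter-< : ∀ {n} s f → (∀ x → x < n → f x < n) → ∀ y → y < n → iter s f y < n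
iter-< zero    f f< y y<n = y<n
iter-< (suc s) f f< y y<n = iter-< s f f< (f y) (f< y y<n)

iter-shift : ∀ c s (a : ℕ → ℕ) y
  → iter s (blockMap c (λ b → shift c (a b))) y ≡ blockMap c (λ b → shift c (s * a b)) y
iter-shift c zero    a y = sym (blockMap-id c (λ b → shift c 0) y (shift-multiple c 0 _ (m%n<n y (suc c))))
iter-shift c (suc s) a y = begin
  iter s (blockMap c (λ b → shift c (a b))) (blockMap c (λ b → shift c (a b)) y) ≡⟨ iter-shift c s a _ ⟩
  blockMap c (λ b → shift c (s * a b)) (blockMap c (λ b → shift c (a b)) y)      ≡⟨ blockMap-∘ c (λ b → shift c (a b)) (λ b → shift c (s * a b)) y
                                                                                        (shift-< c (a (y / suc c)) (y % suc c)) ⟩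
  blockMap c (λ b t → shift c (s * a b) (shift c (a b) t)) y                     ≡⟨ cong (λ z → (y / suc c) * suc c + z)
                                                                                        (shift-∘ c _ (s * a (y / suc c)) (y % suc c)) ⟩
  blockMap c (λ b → shift c (suc s * a b)) y                                     ∎
  where open ≡-Reasoning

-- σ_{c+1}⁻¹ is the block map shifting every block by c (i.e. by -1).
rotInv-blockMap : ∀ c y → rotInv (suc c) y ≡ blockMap c (λ _ → shift c c) y
rotInv-blockMap c y with y % suc c in eq
... | zero = begin
  y + suc c ∸ 1                      ≡⟨ cong (_∸ 1) (+-suc y c) ⟩
  y + c                              ≡⟨ cong (_+ c) (trans (div-mod-eq c y) (cong (q * suc c +_) eq)) ⟩
  q * suc c + 0 + c                  ≡⟨ cong (_+ c) (+-identityʳ _) ⟩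
  q * suc c + c                      ≡⟨ cong (q * suc c +_) (sym (m<n⇒m%n≡m (n<1+n c))) ⟩
  q * suc c + c % suc c              ∎
  where open ≡-Reasoning
        q = y / suc c
... | suc t = begin
  y ∸ 1                              ≡⟨ cong (_∸ 1) (trans (div-mod-eq c y) (cong (q * suc c +_) eq)) ⟩
  q * suc c + suc t ∸ 1              ≡⟨ cong (_∸ 1) (+-suc _ t) ⟩
  q * suc c + t                      ≡⟨ cong (q * suc c +_) (sym (trans ([m+n]%n≡m%n t (suc c)) (m<n⇒m%n≡m t<c))) ⟩
  q * suc c + (t + suc c) % suc c    ≡⟨ cong (λ z → q * suc c + z % suc c) (+-suc t c) ⟩
  q * suc c + (suc t + c) % suc c    ∎
  where open ≡-Reasoning
        q = y / suc c
        t<c : t < suc c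
        t<c = <-trans (n<1+n t) (subst (_< suc c) eq (m%n<n y (suc c)))

rotInv-Perm : ∀ {n c} → c ∣ n → 1 ≤ n → Perm n (rotInv c)
rotInv-Perm {c = c} c∣n 1≤n with divisor-pos c∣n 1≤n | c∣n
... | s≤s {n = c′} _ | divides m refl =
  Perm-ext (λ x _ → sym (rotInv-blockMap c′ x))
    (blockMap-Perm c′ m (λ _ → shift c′ c′) (λ _ → shift c′ (c′ * c′)) (λ _ t _ → shift-< c′ c′ t) (λ _ t _ → shift-< c′ _ t)
      (λ _ → shift-inverse c′ c′) (λ _ → shift-inverseʳ c′ c′))

rotInv-block : ∀ c x → 1 ≤ c → quot (rotInv c x) c ≡ quot x c
rotInv-block (suc c) x _ = trans (cong (_/ suc c) (rotInv-blockMap c x)) (blockMap-block c (λ _ → shift c c) x (shift-< c c (x % suc c)))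

rotInv-< : ∀ {n c} → c ∣ n → 1 ≤ n → ∀ x → x < n → rotInv c x < n
rotInv-< c∣n 1≤n = Perm.π< (rotInv-Perm c∣n 1≤n)

lookup-rotPow : ∀ {n} c m (A : Subset n) → (∀ x → x < n → rotInv c x < n) → ∀ y → y < n
  → lookupℕ (rotPow c m A) y ≡ lookupℕ A (iter m (rotInv c) y)
lookup-rotPow c zero    A rot< y y<n = refl
lookup-rotPow c (suc m) A rot< y y<n =
  trans (lookup-pullback (rotInv c) (rotPow c m A) y y<n) (lookup-rotPow c m A rot< (rotInv c y) (rot< y y<n))

rotPow-+ : ∀ {n} c a b (A : Subset n) → rotPow c (a + b) A ≡ rotPow c a (rotPow c b A)
rotPow-+ c zero    b A = refl
rotPow-+ c (suc a) b A = cong (rot c) (rotPow-+ c a b A)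

SameCounts : ∀ {n} → ℕ → Subset n → Subset n → Set
SameCounts {n} c A B = ∀ j → j < quot n c → blockSum c A j ≡ blockSum c B j

blockSum-coarsen : ∀ {n} c q (A : Subset n) j
  → blockSum (suc q * suc c) A j ≡ ∑ (suc q) (λ t → blockSum (suc c) A (j * suc q + t))
blockSum-coarsen {n} c q A j = begin
  ∑ n (λ x → χ A x * δ (quot x (suc q * suc c)) j)                    ≡⟨ ∑-cong n (λ x _ → cong (λ z → χ A x * δ z j) (coarse-div x)) ⟩
  ∑ n (λ x → χ A x * δ (x / suc c / suc q) j)                         ≡⟨ ∑-cong n (λ x _ → cong (χ A x *_) (δ-div q (x / suc c) j)) ⟩
  ∑ n (λ x → χ A x * ∑ (suc q) (λ t → δ (x / suc c) (j * suc q + t))) ≡⟨ ∑-cong n (λ x _ → sym (∑-*ˡ (suc q) (χ A x) (λ t → δ (x / suc c) (j * suc q + t)))) ⟩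
  ∑ n (λ x → ∑ (suc q) (λ t → χ A x * δ (x / suc c) (j * suc q + t))) ≡⟨ ∑-swap n (suc q) (λ x t → χ A x * δ (x / suc c) (j * suc q + t)) ⟩
  ∑ (suc q) (λ t → blockSum (suc c) A (j * suc q + t))                ∎
  where
  open ≡-Reasoning
  coarse-div : ∀ x → quot x (suc q * suc c) ≡ x / suc c / suc q
  coarse-div x = trans (cong (quot x) (*-comm (suc q) (suc c))) (sym (m/n/o≡m/[n*o] x (suc c) (suc q)))

SameCounts-coarsen : ∀ {n D c} {A B : Subset n} → D ∣ c → c ∣ n → 1 ≤ n → SameCounts D A B → SameCounts c A B
SameCounts-coarsen {n} {D} {c} {A} {B} D∣c c∣n 1≤n same
  with divisor-pos (∣-trans D∣c c∣n) 1≤n | divisor-pos c∣n 1≤n | D∣c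
... | s≤s {n = d} _ | c≥1 | divides zero    refl = ⊥-elim (<-irrefl refl c≥1)
... | s≤s {n = d} _ | _   | divides (suc q) refl with c∣n
...   | divides N refl = λ j j<N → begin
  blockSum (suc q * suc d) A j                                ≡⟨ blockSum-coarsen d q A j ⟩
  ∑ (suc q) (λ t → blockSum (suc d) A (j * suc q + t))        ≡⟨ ∑-cong (suc q) (λ t t<q → same _ (fine-index j t (j<N′ j<N) t<q)) ⟩
  ∑ (suc q) (λ t → blockSum (suc d) B (j * suc q + t))        ≡⟨ sym (blockSum-coarsen d q B j) ⟩
  blockSum (suc q * suc d) B j                                ∎
  where
  open ≡-Reasoning
  c′ = suc q * suc d
  j<N′ : ∀ {j} → j < quot (N * c′) c′ → j < N
  j<N′ = subst (_ <_) (m*n/n≡m N c′)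
  fine-index : ∀ j t → j < N → t < suc q → j * suc q + t < quot (N * c′) (suc d)
  fine-index j t j<N t<q = subst (j * suc q + t <_) (sym (trans (cong (_/ suc d) (sym (*-assoc N (suc q) (suc d))))
                                                        (m*n/n≡m (N * suc q) (suc d))))
                                  (grid-< j<N t<q)

blockCounts-cong : ∀ {n} c {A B : Subset n} → SameCounts c A B → blockCounts c A ≡ blockCounts c B
blockCounts-cong {n} c {A} {B} same = map-cong (quot n c) (λ x → x) (λ j j<m →
  trans (blockCount≡blockSum c A j) (trans (same j j<m) (sym (blockCount≡blockSum c B j))))
  where
  map-cong : ∀ m (h : ℕ → ℕ) {f g : ℕ → ℕ} → (∀ j → j < m → f (h j) ≡ g (h j)) → map f (applyUpTo h m) ≡ map g (applyUpTo h m)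
  map-cong zero    h eq = refl
  map-cong (suc m) h eq = cong₂ _∷_ (eq 0 z<s) (map-cong m (h ∘ suc) (λ j j<m → eq (suc j) (s<s j<m)))

gcdBlocks-cong : ∀ {n} c {A B : Subset n} → SameCounts c A B → gcdBlocks c A ≡ gcdBlocks c B
gcdBlocks-cong c same = cong (foldr gcd c) (blockCounts-cong c same)

∑-blockSum : ∀ {n} c M (A : Subset n) → n ≡ M * suc c → ∑ M (blockSum (suc c) A) ≡ ∣ A ∣
∑-blockSum {n} c M A n≡ = begin
  ∑ M (λ j → ∑ n (λ x → χ A x * δ (x / suc c) j)) ≡⟨ ∑-swap M n (λ j x → χ A x * δ (x / suc c) j) ⟩
  ∑ n (λ x → ∑ M (λ j → χ A x * δ (x / suc c) j)) ≡⟨ ∑-cong n (λ x x<n → trans (∑-*ˡ M (χ A x) (δ (x / suc c)))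
                                                          (trans (cong (χ A x *_) (∑-δ-one M _ (block< x<n))) (*-identityʳ (χ A x)))) ⟩
  ∑ n (χ A)                                       ≡⟨ sym (card-∑ A) ⟩
  ∣ A ∣                                           ∎
  where
  open ≡-Reasoning
  block< : ∀ {x} → x < n → x / suc c < M
  block< {x} x<n = m<n*o⇒m/o<n {x} {M} {suc c} (subst (x <_) n≡ x<n)

All-applyUpTo⁻ : ∀ {P : ℕ → Set} m h → All P (applyUpTo h m) → ∀ i → i < m → P (h i)
All-applyUpTo⁻ (suc m) h (p ∷ ps) zero    _         = p
All-applyUpTo⁻ (suc m) h (p ∷ ps) (suc i) (s<s i<m) = All-applyUpTo⁻ m (h ∘ suc) ps i i<m

All-applyUpTo⁺ : ∀ {P : ℕ → Set} m h → (∀ i → i < m → P (h i)) → All P (applyUpTo h m)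
All-applyUpTo⁺ zero    h f = []
All-applyUpTo⁺ (suc m) h f = f 0 z<s ∷ All-applyUpTo⁺ m (h ∘ suc) (λ i i<m → f (suc i) (s<s i<m))

sumV-tabulated : ∀ m (α : Vec ℕ m) (f : ℕ → ℕ) → (∀ (j : Fin m) → f (toℕ j) ≡ lookup α j) → sumV α ≡ ∑ m f
sumV-tabulated zero    []      f eq = refl
sumV-tabulated (suc m) (a ∷ α) f eq = cong₂ _+_ (sym (eq fzero)) (sumV-tabulated m α (f ∘ suc) (eq ∘ fsuc))

gcdV-tabulated : ∀ c m (α : Vec ℕ m) (f h : ℕ → ℕ) → (∀ (j : Fin m) → f (h (toℕ j)) ≡ lookup α j)
  → gcdV c α ≡ foldr gcd c (map f (applyUpTo h m))
gcdV-tabulated c zero    []      f h eq = refl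
gcdV-tabulated c (suc m) (a ∷ α) f h eq = cong₂ gcd (sym (eq fzero)) (gcdV-tabulated c m α f (h ∘ suc) (eq ∘ fsuc))

BlockInvariant : ∀ {n} → ℕ → (Subset n → Set) → Set
BlockInvariant {n} c G =
  ∀ {π} → Perm n π → (∀ x → x < n → quot (π x) c ≡ quot x c) → ∀ A → G A → G (pullback π A)

module DivisorChain (n k r : ℕ) (1≤n : 1 ≤ n) (1≤r : 1 ≤ r) (es : ℕ → ℕ)
  (es∣ : ∀ i → i < r → es i ∣ es (suc i)) (es-r : es r ≡ n) where

  e d : ℕ
  e = es 0
  d = es 1

  GD : Subset n → Set
  GD = InGD {n} k r es

  chain∣ : ∀ j → j ≤ r → ∀ i → i ≤ j → es i ∣ es j
  chain∣ zero    _   zero _   = ∣-refl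
  chain∣ (suc j) j<r i  i≤1+j with i ≟ suc j
  ... | yes refl = ∣-refl
  ... | no  i≢   = ∣-trans (chain∣ j (≤-trans (n≤1+n j) j<r) i (≤-pred (≤∧≢⇒< i≤1+j i≢))) (es∣ j j<r)

  es∣n : ∀ i → i ≤ r → es i ∣ n
  es∣n i i≤r = subst (es i ∣_) es-r (chain∣ r ≤-refl i i≤r)

  e∣d : e ∣ d
  e∣d = chain∣ 1 1≤r 0 z≤n

  d∣n : d ∣ n
  d∣n = es∣n 1 1≤r

  1≤d : 1 ≤ d
  1≤d = divisor-pos d∣n 1≤n

  -- Membership in GD depends only on the cardinality and the d-block counts,
  -- because every e_{i+1} (i < r) is a multiple of d.
  GD-sameCounts : ∀ {A B} → ∣ A ∣ ≡ k → SameCounts d A B → GD B → GD A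
  GD-sameCounts {A} {B} ∣A∣ same (_ , gcdsB) = ∣A∣ , All-applyUpTo⁺ r (λ i → i) λ i i<r →
    ∣A∣ , trans (gcdBlocks-cong (es (suc i))
                  (SameCounts-coarsen {A = A} {B} (chain∣ (suc i) i<r 1 (s≤s z≤n)) (es∣n (suc i) i<r) 1≤n same))
                (proj₂ (All-applyUpTo⁻ r (λ i → i) gcdsB i i<r))

  GD-gcd : ∀ A → GD A → gcdBlocks d A ≡ e
  GD-gcd A (_ , gcds) = proj₂ (All-applyUpTo⁻ r (λ i → i) gcds 0 1≤r)

  GD-card : ∀ A → GD A → ∣ A ∣ ≡ k
  GD-card A = proj₁

  GD-blockInvariant : BlockInvariant d GD
  GD-blockInvariant P inBlock A gA =
    GD-sameCounts (trans (card-pullback P A) (GD-card A gA)) (λ j _ → blockSum-pullback P d inBlock A j) gA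

  -- Part (i).  The compositions α that occur are the d-block count vectors
  -- of members of GD.
  Occurs : Vec ℕ (quot n d) → Set
  Occurs α = Σ (Subset n) λ B → GD B × InSα k d α B

  n≡blocks*d : n ≡ quot n d * d
  n≡blocks*d with d | 1≤d | d∣n
  ... | suc d′ | _ | divides M eq = trans eq (cong (_* suc d′) (sym (trans (cong (_/ suc d′) eq) (m*n/n≡m M (suc d′)))))

  occurs-composition : ∀ α → Occurs α → sumV α ≡ k × gcdV d α ≡ e
  occurs-composition α (B , gB , ∣B∣ , countsB) =
    trans (sumV-tabulated _ α (blockCount d B) countsB) (total d n≡blocks*d) ,
    trans (gcdV-tabulated d (quot n d) α (blockCount d B) (λ x → x) countsB) (GD-gcd B gB)
    where
    total : ∀ D → n ≡ quot n D * D → ∑ (quot n D) (blockCount D B) ≡ k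
    total zero    eq = ⊥-elim (<-irrefl refl (subst (1 ≤_) (trans eq (*-zeroʳ (quot n 0))) 1≤n))
    total (suc D) eq = trans (∑-cong (quot n (suc D)) (λ j _ → blockCount≡blockSum (suc D) B j))
                             (trans (∑-blockSum D (quot n (suc D)) B eq) ∣B∣)

  GD⇔occurs : ∀ (A : Subset n) → InS k A → (GD A ⇔ (∃[ α ] (Occurs α × InSα k d α A)))
  GD⇔occurs A ∣A∣ = mk⇔ to from
    where
    to : GD A → ∃[ α ] (Occurs α × InSα k d α A)
    to gA = α , (A , gA , inSα) , inSα
      where
      α = tabulate (λ j → blockCount d A (toℕ j))
      inSα : InSα k d α A
      inSα = ∣A∣ , λ j → sym (lookup∘tabulate _ j)
    from : ∃[ α ] (Occurs α × InSα k d α A) → GD A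
    from (α , (B , gB , _ , countsB) , (_ , countsA)) = GD-sameCounts ∣A∣ same gB
      where
      same : SameCounts d A B
      same j j<m = begin
        blockSum d A j                  ≡⟨ sym (blockCount≡blockSum d A j) ⟩
        blockCount d A j                ≡⟨ cong (blockCount d A) (sym (toℕ-fromℕ< j<m)) ⟩
        blockCount d A (toℕ (fromℕ< j<m)) ≡⟨ trans (countsA (fromℕ< j<m)) (sym (countsB (fromℕ< j<m))) ⟩
        blockCount d B (toℕ (fromℕ< j<m)) ≡⟨ cong (blockCount d B) (toℕ-fromℕ< j<m) ⟩
        blockCount d B j                ≡⟨ blockCount≡blockSum d B j ⟩
        blockSum d B j                  ∎
        where open ≡-Reasoning

  -- Part (ii).  σ_d and σ_e map every d-block into itself (e ∣ d).
  GD-rot : ∀ A → GD A → GD (rot d A) × GD (rot e A)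
  GD-rot A gA =
    GD-blockInvariant (rotInv-Perm d∣n 1≤n) (λ x _ → rotInv-block d x 1≤d) A gA ,
    GD-blockInvariant (rotInv-Perm (∣-trans e∣d d∣n) 1≤n)
      (λ x _ → same-block-coarsen e∣d 1≤d (rotInv e x) x (rotInv-block e x (divisor-pos e∣d 1≤d))) A gA

rotInv-translate : ∀ c a t → rotInv (suc c) (a * suc c + t) ≡ a * suc c + rotInv (suc c) t
rotInv-translate c a t = begin
  rotInv (suc c) (a * suc c + t)                                      ≡⟨ rotInv-blockMap c (a * suc c + t) ⟩
  ((a * suc c + t) / suc c) * suc c + shift c c ((a * suc c + t) % suc c) ≡⟨ cong₂ (λ u v → u * suc c + shift c c v) quotient remainder ⟩
  (a + t / suc c) * suc c + shift c c (t % suc c)                     ≡⟨ cong (_+ shift c c (t % suc c)) (*-distribʳ-+ (suc c) a (t / suc c)) ⟩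
  a * suc c + t / suc c * suc c + shift c c (t % suc c)               ≡⟨ +-assoc (a * suc c) _ _ ⟩
  a * suc c + blockMap c (λ _ → shift c c) t                          ≡⟨ cong (a * suc c +_) (sym (rotInv-blockMap c t)) ⟩
  a * suc c + rotInv (suc c) t                                        ∎
  where
  open ≡-Reasoning
  quotient : (a * suc c + t) / suc c ≡ a + t / suc c
  quotient = trans (+-distrib-/-∣ˡ t (divides-refl a)) (cong (_+ t / suc c) (m*n/n≡m a (suc c)))
  remainder : (a * suc c + t) % suc c ≡ t % suc c
  remainder = trans (cong (_% suc c) (+-comm (a * suc c) t)) ([m+kn]%n≡m%n t a (suc c))

grid-mod : ∀ e′ h′ u q → q < suc h′ → (u * suc h′ + q) % (suc h′ * suc e′) ≡ (u % suc e′) * suc h′ + q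
grid-mod e′ h′ u q q<h = begin
  (u * h + q) % D                            ≡⟨ cong (λ z → (z * h + q) % D) (div-mod-eq e′ u) ⟩
  (((u / e) * e + u % e) * h + q) % D        ≡⟨ cong (_% D) (regroup (u / e) (u % e) e h q) ⟩
  ((u % e) * h + q + (u / e) * D) % D        ≡⟨ [m+kn]%n≡m%n ((u % e) * h + q) (u / e) D ⟩
  ((u % e) * h + q) % D                      ≡⟨ m<n⇒m%n≡m (subst ((u % e) * h + q <_) (*-comm e h) (grid-< (m%n<n u e) q<h)) ⟩
  (u % e) * h + q                            ∎
  where
  open ≡-Reasoning
  e = suc e′
  h = suc h′
  D = h * e
  regroup : ∀ a b e h q → (a * e + b) * h + q ≡ b * h + q + a * (h * e)
  regroup = solve-∀

-- Write d = h·e.  Inside a d-block, the position t = q·e + s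
-- (s < e the position inside the e-block q) is sent by τ to s·h + q: τ
-- transposes the e × h grid.  Under this relabelling, σ_e (which cycles s)
-- becomes σ_d^h (which adds h modulo d), so  ρ = τ applied in every d-block
-- conjugates the C_e-action to the action of C′_e = ⟨σ_d^{d/e}⟩.
module Interleave (e′ h′ : ℕ) where
  e h D d′ : ℕ
  e  = suc e′
  h  = suc h′
  D  = h * e
  d′ = e′ + h′ * suc e′

  τ τ′ : ℕ → ℕ
  τ  t = (t % e) * h + t / e
  τ′ u = (u % h) * e + u / h

  τ< : ∀ t → t < D → τ t < D
  τ< t t<D = subst (τ t <_) (*-comm e h) (grid-< (m%n<n t e) (m<n*o⇒m/o<n {t} {h} {e} t<D))

  τ′< : ∀ u → u < D → τ′ u < D
  τ′< u u<D = grid-< (m%n<n u h) (m<n*o⇒m/o<n {u} {e} {h} (subst (u <_) (*-comm h e) u<D))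

  τ′∘τ : ∀ t → t < D → τ′ (τ t) ≡ t
  τ′∘τ t t<D rewrite mod-of-block h′ (t % e) (t / e) (m<n*o⇒m/o<n {t} {h} {e} t<D)
                   | div-of-block h′ (t % e) (t / e) (m<n*o⇒m/o<n {t} {h} {e} t<D) = sym (div-mod-eq e′ t)

  τ∘τ′ : ∀ u → u < D → τ (τ′ u) ≡ u
  τ∘τ′ u u<D = undo (m<n*o⇒m/o<n {u} {e} {h} (subst (u <_) (*-comm h e) u<D))
    where
    undo : u / h < e → τ (τ′ u) ≡ u
    undo u/h<e rewrite mod-of-block e′ (u % h) (u / h) u/h<e | div-of-block e′ (u % h) (u / h) u/h<e = sym (div-mod-eq h′ u)

  ρ : ℕ → ℕ
  ρ = blockMap d′ (λ _ → τ)

  ρ-Perm : ∀ M → Perm (M * D) ρ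
  ρ-Perm M = blockMap-Perm d′ M (λ _ → τ) (λ _ → τ′) (λ _ → τ<) (λ _ → τ′<) (λ _ → τ′∘τ) (λ _ → τ∘τ′)

  ρ-block : ∀ x → ρ x / D ≡ x / D
  ρ-block x = blockMap-block d′ (λ _ → τ) x (τ< _ (m%n<n x D))

  ρ⁻¹-block : ∀ x → blockMap d′ (λ _ → τ′) x / D ≡ x / D
  ρ⁻¹-block x = blockMap-block d′ (λ _ → τ′) x (τ′< _ (m%n<n x D))

  rotInv-e< : ∀ t → t < D → rotInv e t < D
  rotInv-e< = rotInv-< (divides h refl) (s≤s z≤n)

  rotInv-e-blockMap : ∀ y → rotInv e y ≡ blockMap d′ (λ _ → rotInv e) y
  rotInv-e-blockMap y = begin
    rotInv e y                                ≡⟨ cong (rotInv e) (trans (div-mod-eq d′ y) (cong (_+ y % D) (sym (*-assoc (y / D) h e)))) ⟩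
    rotInv e ((y / D) * h * e + y % D)        ≡⟨ rotInv-translate e′ ((y / D) * h) (y % D) ⟩
    (y / D) * h * e + rotInv e (y % D)        ≡⟨ cong (_+ rotInv e (y % D)) (*-assoc (y / D) h e) ⟩
    blockMap d′ (λ _ → rotInv e) y            ∎
    where open ≡-Reasoning

  τ-conjugates : ∀ t → t < D → shift d′ (h * d′) (τ t) ≡ τ (rotInv e t)
  τ-conjugates t t<D = begin
    ((t % e) * h + t / e + h * d′) % D                ≡⟨ cong (_% D) (regroup e′ h′ (t % e) (t / e)) ⟩
    ((t % e + e′) * h + t / e + h′ * D) % D           ≡⟨ [m+kn]%n≡m%n ((t % e + e′) * h + t / e) h′ D ⟩
    ((t % e + e′) * h + t / e) % D                    ≡⟨ grid-mod e′ h′ (t % e + e′) (t / e) (m<n*o⇒m/o<n {t} {h} {e} t<D) ⟩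
    shift e′ e′ (t % e) * h + t / e                   ≡⟨ sym (cong₂ (λ u v → u * h + v) (mod-of-block e′ (t / e) _ (shift-< e′ e′ (t % e)))
                                                                                      (div-of-block e′ (t / e) _ (shift-< e′ e′ (t % e)))) ⟩
    τ ((t / e) * e + shift e′ e′ (t % e))             ≡⟨ cong τ (sym (rotInv-blockMap e′ t)) ⟩
    τ (rotInv e t)                                    ∎
    where
    open ≡-Reasoning
    regroup : ∀ e′ h′ s q → s * suc h′ + q + suc h′ * (e′ + h′ * suc e′) ≡ (s + e′) * suc h′ + q + h′ * (suc h′ * suc e′)
    regroup = solve-∀

  ρ-conjugates : ∀ y → iter h (rotInv D) (ρ y) ≡ ρ (rotInv e y)
  ρ-conjugates y = begin
    iter h (rotInv D) (ρ y)                                      ≡⟨ iter-cong h (rotInv-blockMap d′) (ρ y) ⟩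
    iter h (blockMap d′ (λ _ → shift d′ d′)) (ρ y)               ≡⟨ iter-shift d′ h (λ _ → d′) (ρ y) ⟩
    blockMap d′ (λ _ → shift d′ (h * d′)) (ρ y)                  ≡⟨ blockMap-∘ d′ (λ _ → τ) (λ _ → shift d′ (h * d′)) y (τ< _ (m%n<n y D)) ⟩
    blockMap d′ (λ _ t → shift d′ (h * d′) (τ t)) y              ≡⟨ blockMap-cong d′ (λ _ → τ-conjugates) y ⟩
    blockMap d′ (λ _ t → τ (rotInv e t)) y                       ≡⟨ sym (blockMap-∘ d′ (λ _ → rotInv e) (λ _ → τ) y (rotInv-e< _ (m%n<n y D))) ⟩
    ρ (blockMap d′ (λ _ → rotInv e) y)                           ≡⟨ cong ρ (sym (rotInv-e-blockMap y)) ⟩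
    ρ (rotInv e y)                                               ∎
    where open ≡-Reasoning

  ρ-conjugates-iter : ∀ m y → iter (h * m) (rotInv D) (ρ y) ≡ ρ (iter m (rotInv e) y)
  ρ-conjugates-iter zero    y rewrite *-zeroʳ h = refl
  ρ-conjugates-iter (suc m) y = begin
    iter (h * suc m) (rotInv D) (ρ y)                   ≡⟨ cong (λ z → iter z (rotInv D) (ρ y)) (*-suc h m) ⟩
    iter (h + h * m) (rotInv D) (ρ y)                   ≡⟨ iter-+ h (h * m) (rotInv D) (ρ y) ⟩
    iter (h * m) (rotInv D) (iter h (rotInv D) (ρ y))   ≡⟨ cong (iter (h * m) (rotInv D)) (ρ-conjugates y) ⟩
    iter (h * m) (rotInv D) (ρ (rotInv e y))            ≡⟨ ρ-conjugates-iter m (rotInv e y) ⟩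
    ρ (iter (suc m) (rotInv e) y)                       ∎
    where open ≡-Reasoning

-- Part (iii) for any family G that is block-invariant for d: with φ = id,
-- ψ = pullback along ρ is a bijection of G (inverse: pullback along ρ⁻¹)
-- intertwining σ_d^{(d/e)·m} with σ_e^m.
Ce′≅Ce : ∀ {n} (G : Subset n → Set) e d → e ∣ d → d ∣ n → 1 ≤ n → BlockInvariant d G
  → Σ (ℕ → ℕ) λ φ → Σ (Subset n → Subset n) λ ψ → Σ (Subset n → Subset n) λ ψ′
      → (∀ a b → φ (a + b) ≡ φ a + φ b [mod e ])
      × (∀ a b → φ a ≡ φ b [mod e ] → a ≡ b [mod e ])
      × (∀ b → ∃[ a ] (φ a ≡ b [mod e ]))
      × (∀ A → G A → G (ψ A) × G (ψ′ A) × ψ′ (ψ A) ≡ A × ψ (ψ′ A) ≡ A)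
      × (∀ m A → G A → ψ (rotPow d (quot d e * m) A) ≡ rotPow e (φ m) (ψ A))
Ce′≅Ce G e d e∣d d∣n 1≤n invariant with divisor-pos (∣-trans e∣d d∣n) 1≤n | divisor-pos d∣n 1≤n | e∣d
... | _ | 1≤d | divides zero refl = ⊥-elim (<-irrefl refl 1≤d)
... | s≤s {n = e′} _ | _ | divides (suc h′) refl with d∣n
...   | divides M refl =
  (λ m → m) , pullback ρ , pullback (Perm.inv P) ,
  (λ _ _ → refl) , (λ _ _ eq → eq) , (λ b → b , refl) ,
  (λ A gA → invariant P (λ x _ → ρ-block x) A gA , invariant P⁻¹ (λ x _ → ρ⁻¹-block x) A gA ,
            pullback-inverse P A , pullback-inverse P⁻¹ A) ,
  equivariant
  where
  open Interleave e′ h′ hiding (e)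
  P  = ρ-Perm M
  P⁻¹ = Perm-inverse P
  n′ = M * D
  equivariant : ∀ m A → G A → pullback ρ (rotPow D (quot D e * m) A) ≡ rotPow e m (pullback ρ A)
  equivariant m A _ = trans (cong (λ z → pullback ρ (rotPow D (z * m) A)) (m*n/n≡m h e)) (subset-ext _ _ λ y y<n → begin
    lookupℕ (pullback ρ (rotPow D (h * m) A)) y  ≡⟨ lookup-pullback ρ (rotPow D (h * m) A) y y<n ⟩
    lookupℕ (rotPow D (h * m) A) (ρ y)           ≡⟨ lookup-rotPow D (h * m) A (rotInv-< (divides M refl) 1≤n) (ρ y) (Perm.π< P y y<n) ⟩
    lookupℕ A (iter (h * m) (rotInv D) (ρ y))    ≡⟨ cong (lookupℕ A) (ρ-conjugates-iter m y) ⟩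
    lookupℕ A (ρ (iter m (rotInv e) y))          ≡⟨ sym (lookup-pullback ρ A _ (iter-< m (rotInv e) rotInv-e-n y y<n)) ⟩
    lookupℕ (pullback ρ A) (iter m (rotInv e) y) ≡⟨ sym (lookup-rotPow e m (pullback ρ A) rotInv-e-n y y<n) ⟩
    lookupℕ (rotPow e m (pullback ρ A)) y        ∎)
    where
    open ≡-Reasoning
    rotInv-e-n : ∀ x → x < n′ → rotInv e x < n′
    rotInv-e-n = rotInv-< (∣-trans (divides h refl) (divides M refl)) 1≤n

least-below : ∀ {Q : ℕ → Set} → (∀ s → Dec (Q s)) → ∀ N
  → (Σ ℕ λ s → s < N × Q s × (∀ s′ → s′ < s → ¬ Q s′)) ⊎ (∀ s → s < N → ¬ Q s)
least-below Q? zero = inj₂ (λ s ())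
least-below {Q} Q? (suc N) with least-below Q? N
... | inj₁ (s , s<N , q , minimal) = inj₁ (s , <-trans s<N (n<1+n N) , q , minimal)
... | inj₂ none with Q? N
...   | yes q  = inj₁ (N , n<1+n N , q , none)
...   | no  ¬q = inj₂ λ s s<1+N → case (m≤n⇒m<n∨m≡n (≤-pred s<1+N))
  where
  case : ∀ {s} → s < N ⊎ s ≡ N → ¬ Q s
  case (inj₁ s<N)  = none _ s<N
  case (inj₂ refl) = ¬q

blockSum-block : ∀ c M (A : Subset (M * suc c)) j → j < M → blockSum (suc c) A j ≡ ∑ (suc c) (λ u → χ A (j * suc c + u))
blockSum-block c M A j j<M = begin
  ∑ (M * suc c) (λ x → χ A x * δ (x / suc c) j)                               ≡⟨ ∑-blocks M (suc c) _ ⟩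
  ∑ M (λ v → ∑ (suc c) (λ u → χ A (v * suc c + u) * δ ((v * suc c + u) / suc c) j)) ≡⟨ ∑-cong M (λ v _ → ∑-cong (suc c) (λ u u<c →
                                                                                   cong (χ A (v * suc c + u) *_) (trans (cong (λ z → δ z j) (div-of-block c v u u<c)) (δ-sym v j)))) ⟩
  ∑ M (λ v → ∑ (suc c) (λ u → χ A (v * suc c + u) * δ j v))                    ≡⟨ ∑-cong M (λ v _ → ∑-*ʳ (suc c) (δ j v) (λ u → χ A (v * suc c + u))) ⟩
  ∑ M (λ v → ∑ (suc c) (λ u → χ A (v * suc c + u)) * δ j v)                    ≡⟨ ∑-δ M j (λ v → ∑ (suc c) (λ u → χ A (v * suc c + u))) j<M ⟩
  ∑ (suc c) (λ u → χ A (j * suc c + u))                                        ∎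
  where open ≡-Reasoning

∣-foldr-gcd : ∀ {q c} m (f h : ℕ → ℕ) → q ∣ c → (∀ i → i < m → q ∣ f (h i)) → q ∣ foldr gcd c (map f (applyUpTo h m))
∣-foldr-gcd zero    f h q∣c _   = q∣c
∣-foldr-gcd (suc m) f h q∣c q∣f = gcd-greatest (q∣f 0 z<s) (∣-foldr-gcd m f (h ∘ suc) q∣c (λ i i<m → q∣f (suc i) (s<s i<m)))

-- Let t be the least positive period of A under σ_d.  Then t is
-- the orbit size, t ∣ d, and inside every d-block A is t-periodic, so every
-- d-block count is a multiple of d/t; hence d/t divides gcdBlocks d A.
module Orbit (d′ M : ℕ) (1≤n : 1 ≤ M * suc d′) (A : Subset (M * suc d′)) where
  d n : ℕ
  d = suc d′
  n = M * d

  σ^ : ℕ → Subset n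
  σ^ m = rotPow d m A

  lookup-σ^ : ∀ m y → y < n → lookupℕ (σ^ m) y ≡ lookupℕ A (blockMap d′ (λ _ → shift d′ (m * d′)) y)
  lookup-σ^ m y y<n = trans (lookup-rotPow d m A (rotInv-< (divides M refl) 1≤n) y y<n)
    (cong (lookupℕ A) (trans (iter-cong m (rotInv-blockMap d′) y) (iter-shift d′ m (λ _ → d′) y)))

  σ^d : σ^ d ≡ A
  σ^d = subset-ext _ _ λ y y<n → trans (lookup-σ^ d y y<n) (cong (lookupℕ A) (blockMap-id d′ (λ _ → shift d′ (d * d′)) y
    (trans (cong (λ z → shift d′ z (y % d)) (*-comm d d′)) (shift-multiple d′ d′ _ (m%n<n y d)))))

  least-period : Σ ℕ λ s → s < d × σ^ (suc s) ≡ A × (∀ s′ → s′ < s → σ^ (suc s′) ≢ A)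
  least-period with least-below (λ s → σ^ (suc s) ≟S A) d
  ... | inj₁ found = found
  ... | inj₂ none  = ⊥-elim (none d′ ≤-refl σ^d)

  t : ℕ
  t = suc (proj₁ least-period)

  t≤d : t ≤ d
  t≤d = proj₁ (proj₂ least-period)

  σ^t : σ^ t ≡ A
  σ^t = proj₁ (proj₂ (proj₂ least-period))

  t-least : ∀ s → 0 < s → s < t → σ^ s ≢ A
  t-least (suc s) _ (s<s s<t) = proj₂ (proj₂ (proj₂ least-period)) s s<t

  σ^-periodic : ∀ u w → σ^ (u * t + w) ≡ σ^ w
  σ^-periodic zero    w = refl
  σ^-periodic (suc u) w = begin
    σ^ ((t + u * t) + w)       ≡⟨ cong σ^ (trans (+-assoc t (u * t) w) (+-comm t (u * t + w))) ⟩
    σ^ ((u * t + w) + t)       ≡⟨ rotPow-+ d (u * t + w) t A ⟩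
    rotPow d (u * t + w) (σ^ t) ≡⟨ cong (rotPow d (u * t + w)) σ^t ⟩
    σ^ (u * t + w)             ≡⟨ σ^-periodic u w ⟩
    σ^ w                       ∎
    where open ≡-Reasoning

  σ^-mod : ∀ m → σ^ m ≡ σ^ (m % t)
  σ^-mod m = trans (cong σ^ (div-mod-eq (pred t) m)) (σ^-periodic (m / t) (m % t))

  t∣d : d ≡ (d / t) * t
  t∣d with d % t in eq
  ... | zero  = trans (div-mod-eq (pred t) d) (trans (cong ((d / t) * t +_) eq) (+-identityʳ _))
  ... | suc x = ⊥-elim (t-least (suc x) z<s (subst (_< t) eq (m%n<n d t)) (trans (subst (λ z → σ^ z ≡ σ^ d) eq (sym (σ^-mod d))) σ^d))

  -- σ^ i = σ^ j with i < j < t would give the earlier return σ^ (j ∸ i) = A.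
  no-earlier-return : ∀ {i j} → i < j → j < t → σ^ i ≡ σ^ j → ⊥
  no-earlier-return {i} {j} i<j j<t σ^i≡σ^j = t-least (j ∸ i) (m<n⇒0<n∸m i<j) (≤-<-trans (m∸n≤m j i) j<t) (begin
    σ^ (j ∸ i)                      ≡⟨ cong (rotPow d (j ∸ i)) (sym σ^d) ⟩
    rotPow d (j ∸ i) (σ^ d)         ≡⟨ sym (rotPow-+ d (j ∸ i) d A) ⟩
    σ^ ((j ∸ i) + d)                ≡⟨ cong σ^ (reorder (<⇒≤ i<j) (≤-trans (<⇒≤ (<-trans i<j j<t)) t≤d)) ⟩
    σ^ ((d ∸ i) + j)                ≡⟨ rotPow-+ d (d ∸ i) j A ⟩
    rotPow d (d ∸ i) (σ^ j)         ≡⟨ cong (rotPow d (d ∸ i)) (sym σ^i≡σ^j) ⟩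
    rotPow d (d ∸ i) (σ^ i)         ≡⟨ sym (rotPow-+ d (d ∸ i) i A) ⟩
    σ^ ((d ∸ i) + i)                ≡⟨ cong σ^ (m∸n+n≡m (≤-trans (<⇒≤ (<-trans i<j j<t)) t≤d)) ⟩
    σ^ d                            ≡⟨ σ^d ⟩
    A                               ∎)
    where
    open ≡-Reasoning
    reorder : ∀ {i j} → i ≤ j → i ≤ d → (j ∸ i) + d ≡ (d ∸ i) + j
    reorder {i} {j} i≤j i≤d = +-cancelʳ-≡ i _ _ (begin
      j ∸ i + d + i   ≡⟨ trans (+-assoc (j ∸ i) d i) (trans (cong (j ∸ i +_) (+-comm d i)) (sym (+-assoc (j ∸ i) i d))) ⟩
      j ∸ i + i + d   ≡⟨ cong (_+ d) (m∸n+n≡m i≤j) ⟩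
      j + d           ≡⟨ +-comm j d ⟩
      d + j           ≡⟨ cong (_+ j) (sym (m∸n+n≡m i≤d)) ⟩
      d ∸ i + i + j   ≡⟨ trans (+-assoc (d ∸ i) i j) (trans (cong (d ∸ i +_) (+-comm i j)) (sym (+-assoc (d ∸ i) j i))) ⟩
      d ∸ i + j + i   ∎)

  σ^-injective : ∀ i j → i < t → j < t → σ^ i ≡ σ^ j → i ≡ j
  σ^-injective i j i<t j<t eq with <-cmp i j
  ... | tri≈ _ i≡j _ = i≡j
  ... | tri< i<j _ _ = ⊥-elim (no-earlier-return i<j j<t eq)
  ... | tri> _ _ j<i = ⊥-elim (no-earlier-return j<i i<t (sym eq))

  orbitSize≡t : orbitSize d A ≡ t
  orbitSize≡t = trans (↭-length orbit↭) (length-applyUpTo σ^ t)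
    where
    iterates = map σ^ (upTo d)
    iterates≡ : iterates ≡ applyUpTo σ^ d
    iterates≡ = map-applyUpTo (λ x → x) σ^ d
    to : ∀ {B} → B ∈ deduplicate _≟S_ iterates → B ∈ applyUpTo σ^ t
    to {B} B∈ with ∈-applyUpTo⁻ σ^ (subst (B ∈_) iterates≡ (∈-deduplicate⁻ _≟S_ iterates B∈))
    ... | m , _ , refl = subst (_∈ applyUpTo σ^ t) (sym (σ^-mod m)) (∈-applyUpTo⁺ σ^ (m%n<n m t))
    from : ∀ {B} → B ∈ applyUpTo σ^ t → B ∈ deduplicate _≟S_ iterates
    from B∈ with ∈-applyUpTo⁻ σ^ B∈
    ... | m , m<t , refl = ∈-deduplicate⁺ _≟S_ (subst (σ^ m ∈_) (sym iterates≡) (∈-applyUpTo⁺ σ^ (<-≤-trans m<t t≤d)))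
    orbit↭ = unique-same-elements⇒↭ (DecUnique.deduplicate-! (_≟S_ {n}) iterates) (unique-applyUpTo t σ^ σ^-injective) to from

  -- Since σ_d^t A = A, A is t-periodic inside each d-block.
  χ-step : ∀ j → j < M → ∀ u → u + t < d → χ A (j * d + (u + t)) ≡ χ A (j * d + u)
  χ-step j j<M u u+t<d = cong bit (begin
    lookupℕ A y                                              ≡⟨ cong (λ B → lookupℕ B y) (sym σ^t) ⟩
    lookupℕ (σ^ t) y                                         ≡⟨ lookup-σ^ t y y<n ⟩
    lookupℕ A (blockMap d′ (λ _ → shift d′ (t * d′)) y)      ≡⟨ cong (lookupℕ A) (blockMap-at d′ (λ _ → shift d′ (t * d′)) j (u + t) u+t<d) ⟩
    lookupℕ A (j * d + shift d′ (t * d′) (u + t))            ≡⟨ cong (λ z → lookupℕ A (j * d + z)) wraps ⟩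
    lookupℕ A (j * d + u)                                    ∎)
    where
    open ≡-Reasoning
    y = j * d + (u + t)
    y<n : y < n
    y<n = grid-< j<M u+t<d
    wraps : shift d′ (t * d′) (u + t) ≡ u
    wraps = trans (cong (_% d) (trans (+-assoc u t (t * d′)) (cong (u +_) (sym (*-suc t d′)))))
                  (shift-multiple d′ t u (≤-<-trans (m≤m+n u t) u+t<d))

  χ-periodic : ∀ j → j < M → ∀ v u → v * t + u < d → χ A (j * d + (v * t + u)) ≡ χ A (j * d + u)
  χ-periodic j j<M zero    u _  = refl
  χ-periodic j j<M (suc v) u lt = begin
    χ A (j * d + (t + v * t + u))   ≡⟨ cong (λ z → χ A (j * d + z)) shuffle ⟩
    χ A (j * d + (v * t + u + t))   ≡⟨ χ-step j j<M (v * t + u) (subst (_< d) shuffle lt) ⟩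
    χ A (j * d + (v * t + u))       ≡⟨ χ-periodic j j<M v u (≤-<-trans (m≤m+n (v * t + u) t) (subst (_< d) shuffle lt)) ⟩
    χ A (j * d + u)                 ∎
    where
    open ≡-Reasoning
    shuffle : t + v * t + u ≡ v * t + u + t
    shuffle = trans (+-assoc t (v * t) u) (+-comm t (v * t + u))

  blockSum-multiple : ∀ j → j < M → blockSum d A j ≡ (d / t) * ∑ t (λ u → χ A (j * d + u))
  blockSum-multiple j j<M = begin
    blockSum d A j                                   ≡⟨ blockSum-block d′ M A j j<M ⟩
    ∑ d g                                            ≡⟨ cong (λ z → ∑ z g) t∣d ⟩
    ∑ (d / t * t) g                                  ≡⟨ ∑-blocks (d / t) t g ⟩
    ∑ (d / t) (λ v → ∑ t (λ u → g (v * t + u)))      ≡⟨ ∑-cong (d / t) (λ v v< → ∑-cong t (λ u u< →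
                                                          χ-periodic j j<M v u (subst (v * t + u <_) (sym t∣d) (grid-< v< u<)))) ⟩
    ∑ (d / t) (λ v → ∑ t g)                          ≡⟨ ∑-const (d / t) (∑ t g) ⟩
    d / t * ∑ t g                                    ∎
    where
    open ≡-Reasoning
    g = λ u → χ A (j * d + u)

  orbit-divides : quot d (orbitSize d A) ∣ gcdBlocks d A
  orbit-divides = subst (λ z → quot d z ∣ gcdBlocks d A) (sym orbitSize≡t) (
    ∣-foldr-gcd (quot n d) (blockCount d A) (λ x → x) (divides t (trans t∣d (*-comm (d / t) t))) λ j j<n/d →
      divides (∑ t (λ u → χ A (j * d + u)))
        (trans (blockCount≡blockSum d A j) (trans (blockSum-multiple j (subst (j <_) (m*n/n≡m M d) j<n/d)) (*-comm (d / t) _))))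

orbit∣gcdBlocks : ∀ {n} d (A : Subset n) → d ∣ n → 1 ≤ n → quot d (orbitSize d A) ∣ gcdBlocks d A
orbit∣gcdBlocks d A d∣n 1≤n with divisor-pos d∣n 1≤n | d∣n
... | s≤s _ | divides M refl = Orbit.orbit-divides (pred d) M 1≤n A

∑-*suc : ∀ m (f : ℕ → ℕ) → ∑ m (λ x → f x * suc x) ≡ ∑ m (λ x → f x * x) + ∑ m f
∑-*suc m f = trans (∑-cong m (λ x _ → trans (*-suc (f x) x) (+-comm (f x) _))) (∑-+ m (λ x → f x * x) f)

-- Σ_{a ∈ A} a ≥ C(#A, 2): the k smallest possible elements are 0, …, k-1.
-- It makes the truncated subtraction in Sum′ exact.
elemSum-lower-bound : ∀ m (g : ℕ → Bool) → ∑ m (bit ∘ g) C 2 ≤ ∑ m (λ x → bit (g x) * x)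
elemSum-lower-bound zero    g = z≤n
elemSum-lower-bound (suc m) g with g 0
... | false = ≤-trans (elemSum-lower-bound m (g ∘ suc))
                (≤-trans (m≤m+n _ _) (≤-reflexive (sym (∑-*suc m (bit ∘ g ∘ suc)))))
... | true  = begin
  suc k C 2                               ≡⟨ sym (nCk+nC[k+1]≡[n+1]C[k+1] k 1) ⟩
  k C 1 + k C 2                           ≡⟨ cong (_+ k C 2) (nC1≡n k) ⟩
  k + k C 2                               ≤⟨ +-monoʳ-≤ k (elemSum-lower-bound m (g ∘ suc)) ⟩
  k + ∑ m (λ x → bit (g (suc x)) * x)     ≡⟨ +-comm k _ ⟩
  ∑ m (λ x → bit (g (suc x)) * x) + k     ≡⟨ sym (∑-*suc m (bit ∘ g ∘ suc)) ⟩
  ∑ m (λ x → bit (g (suc x)) * suc x)     ∎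
  where
  open ≤-Reasoning
  k = ∑ m (bit ∘ g ∘ suc)

module Modulo (d′ : ℕ) where
  D : ℕ
  D = suc d′

  infix 4 _≈_
  _≈_ : ℕ → ℕ → Set
  a ≈ b = a ≡ b [mod D ]

  ≈-+ : ∀ a b c e → a ≈ b → c ≈ e → a + c ≈ b + e
  ≈-+ a b c e p q = trans (%-distribˡ-+ a c D) (trans (cong₂ (λ u v → (u + v) % D) p q) (sym (%-distribˡ-+ b e D)))

  ≈-*ˡ : ∀ k a b → a ≈ b → k * a ≈ k * b
  ≈-*ˡ k a b p = trans (%-distribˡ-* k a D) (trans (cong (λ u → (k % D * u) % D) p) (sym (%-distribˡ-* k b D)))

  ≈-multiple : ∀ a m → a + m * D ≈ a
  ≈-multiple a m = [m+kn]%n≡m%n a m D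

  ≈-cancelʳ : ∀ a b c → a + c ≈ b + c → a ≈ b
  ≈-cancelʳ a b c p = begin
    a % D                    ≡⟨ sym (trans (cong (_% D) (add-multiple a)) (≈-multiple a c)) ⟩
    (a + c + c * d′) % D     ≡⟨ ≈-+ (a + c) (b + c) (c * d′) (c * d′) p refl ⟩
    (b + c + c * d′) % D     ≡⟨ trans (cong (_% D) (add-multiple b)) (≈-multiple b c) ⟩
    b % D                    ∎
    where
    open ≡-Reasoning
    add-multiple : ∀ a → a + c + c * d′ ≡ a + c * D
    add-multiple a = trans (+-assoc a c (c * d′)) (cong (a +_) (sym (*-suc c d′)))

  ∑-≈ : ∀ m (f g : ℕ → ℕ) → (∀ x → x < m → f x ≈ g x) → ∑ m f ≈ ∑ m g
  ∑-≈ zero    f g eq = refl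
  ∑-≈ (suc m) f g eq = ≈-+ (f 0) (g 0) _ _ (eq 0 z<s) (∑-≈ m (f ∘ suc) (g ∘ suc) (λ x x<m → eq (suc x) (s<s x<m)))

  ∸-≈ : ∀ K a b s → K ≤ a → K ≤ b → a ≈ b + s → a ∸ K ≈ (b ∸ K) + s
  ∸-≈ K a b s K≤a K≤b p = ≈-cancelʳ (a ∸ K) ((b ∸ K) + s) K
    (trans (cong (_% D) (m∸n+n≡m K≤a)) (trans p (cong (_% D) b+s≡)))
    where
    b+s≡ : b + s ≡ (b ∸ K) + s + K
    b+s≡ = trans (cong (_+ s) (sym (m∸n+n≡m K≤b))) (trans (+-assoc (b ∸ K) K s)
             (trans (cong ((b ∸ K) +_) (+-comm K s)) (sym (+-assoc (b ∸ K) s K))))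

  -- Negative integer coefficients are represented by multiplying by d′ ≡ -1.
  lin : List ℕ → List ℕ → ℕ
  lin (c ∷ cs) (a ∷ as) = c * a + lin cs as
  lin _        _        = 0

  lin-scale : ∀ k cs as → lin (map (k *_) cs) as ≡ k * lin cs as
  lin-scale k []       as       = sym (*-zeroʳ k)
  lin-scale k (c ∷ cs) []       = sym (*-zeroʳ k)
  lin-scale k (c ∷ cs) (a ∷ as) = trans (cong₂ _+_ (*-assoc k c a) (lin-scale k cs as)) (sym (*-distribˡ-+ k (c * a) _))

  open Bézout using (Identity; +-; -+)

  bézout-step : ∀ {g a g′} → Identity g a g′ → List ℕ → List ℕ
  bézout-step (+- x y _) cs = x ∷ map ((d′ * y) *_) cs
  bézout-step (-+ x y _) cs = (d′ * x) ∷ map (y *_) cs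

  bézout : List ℕ → List ℕ
  bézout []       = []
  bézout (a ∷ as) = bézout-step (Bézout.identity (gcd-GCD a (foldr gcd D as))) (bézout as)

  bézout-step-≈ : ∀ {g a g′} (I : Identity g a g′) cs as → lin cs as ≈ g′ → lin (bézout-step I cs) (a ∷ as) ≈ g
  bézout-step-≈ {g} {a} {g′} (+- x y eq) cs as p =
    trans (≈-+ (x * a) (x * a) _ _ refl (trans (cong (_% D) (lin-scale (d′ * y) cs as)) (≈-*ˡ (d′ * y) _ _ p)))
          (trans (cong (_% D) (trans (cong (_+ d′ * y * g′) (sym eq)) (regroup g y g′ d′))) (≈-multiple g (y * g′)))
    where
    regroup : ∀ g y g′ d′ → g + y * g′ + d′ * y * g′ ≡ g + y * g′ * suc d′
    regroup = solve-∀
  bézout-step-≈ {g} {a} {g′} (-+ x y eq) cs as p =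
    trans (≈-+ (d′ * x * a) (d′ * x * a) _ _ refl (trans (cong (_% D) (lin-scale y cs as)) (≈-*ˡ y _ _ p)))
          (trans (cong (_% D) (trans (cong (d′ * x * a +_) (sym eq)) (regroup g x a d′))) (≈-multiple g (x * a)))
    where
    regroup : ∀ g x a d′ → d′ * x * a + (g + x * a) ≡ g + x * a * suc d′
    regroup = solve-∀

  bézout-≈ : ∀ as → lin (bézout as) as ≈ foldr gcd D as
  bézout-≈ []       = sym (n%n≡0 D)
  bézout-≈ (a ∷ as) = bézout-step-≈ (Bézout.identity (gcd-GCD a (foldr gcd D as))) (bézout as) as (bézout-≈ as)

  -- The b-th entry of a coefficient list (0 past its end).
  coeff : List ℕ → ℕ → ℕ
  coeff []       _       = 0
  coeff (c ∷ cs) zero    = c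
  coeff (c ∷ cs) (suc b) = coeff cs b

  lin-∑ : ∀ M cs (f h : ℕ → ℕ) → lin cs (map f (applyUpTo h M)) ≡ ∑ M (λ b → coeff cs b * f (h b))
  lin-∑ zero    []       f h = refl
  lin-∑ zero    (c ∷ cs) f h = refl
  lin-∑ (suc M) []       f h = sym (∑-zero (suc M) (λ _ _ → refl))
  lin-∑ (suc M) (c ∷ cs) f h = cong (c * f (h 0) +_) (lin-∑ M cs f (h ∘ suc))

count-bijection : ∀ {X : Set} (L : List X) → Unique L → (∀ x → x ∈ L) → (F F⁻¹ : X → X)
  → (∀ x → F⁻¹ (F x) ≡ x) → (∀ x → F (F⁻¹ x) ≡ x)
  → {P Q : X → Set} (P? : Decidable P) (Q? : Decidable Q)
  → (∀ x → P x → Q (F x)) → (∀ x → Q (F x) → P x)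
  → length (filter P? L) ≡ length (filter Q? L)
count-bijection L unique complete F F⁻¹ F⁻¹∘F F∘F⁻¹ {P} {Q} P? Q? P→QF QF→P =
  trans (sym (length-map F (filter P? L))) (↭-length images↭)
  where
  F-injective : ∀ {x y} → F x ≡ F y → x ≡ y
  F-injective {x} {y} eq = trans (sym (F⁻¹∘F x)) (trans (cong F⁻¹ eq) (F⁻¹∘F y))
  to : ∀ {x} → x ∈ map F (filter P? L) → x ∈ filter Q? L
  to x∈ with ∈-map⁻ F x∈
  ... | y , y∈ , refl = ∈-filter⁺ Q? (complete (F y)) (P→QF y (proj₂ (∈-filter⁻ P? {xs = L} y∈)))
  from : ∀ {x} → x ∈ filter Q? L → x ∈ map F (filter P? L)
  from {x} x∈ = subst (_∈ map F (filter P? L)) (F∘F⁻¹ x)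
    (∈-map⁺ F (∈-filter⁺ P? (complete (F⁻¹ x)) (QF→P (F⁻¹ x) (subst Q (sym (F∘F⁻¹ x)) (proj₂ (∈-filter⁻ Q? {xs = L} x∈))))))
  images↭ = unique-same-elements⇒↭ (Unique.map⁺ F-injective (Unique.filter⁺ P? unique)) (Unique.filter⁺ Q? unique) to from

allSubsets-complete : ∀ n (A : Subset n) → A ∈ allSubsets n
allSubsets-complete zero    []          = here refl
allSubsets-complete (suc n) (true ∷ A)  = ∈-++⁺ˡ (∈-map⁺ (true ∷_) (allSubsets-complete n A))
allSubsets-complete (suc n) (false ∷ A) = ∈-++⁺ʳ (map (true ∷_) (allSubsets n)) (∈-map⁺ (false ∷_) (allSubsets-complete n A))

allSubsets-unique : ∀ n → Unique (allSubsets n)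
allSubsets-unique zero    = [] ∷ []
allSubsets-unique (suc n) = Unique.++⁺ (Unique.map⁺ ∷-injectiveʳ (allSubsets-unique n))
                                       (Unique.map⁺ ∷-injectiveʳ (allSubsets-unique n)) disjoint
  where
  ∷-injectiveʳ : ∀ {b : Bool} {x y : Subset n} → b ∷ x ≡ b ∷ y → x ≡ y
  ∷-injectiveʳ refl = refl
  disjoint : ∀ {v} → v ∈ map (true ∷_) (allSubsets n) × v ∈ map (false ∷_) (allSubsets n) → ⊥
  disjoint (p , q) with ∈-map⁻ (true ∷_) p | ∈-map⁻ (false ∷_) q
  ... | _ , _ , refl | _ , _ , ()

-- By Bézout choose c_b with Σ_b c_b · #(A ∩ I_d^b) ≡ gcdBlocks d A
-- (mod d), and let F A add c_b (mod d) to every element of A in block b.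
-- F preserves all d-block counts, hence the c_b and the family, is
-- invertible, and raises Sum′ by gcdBlocks d A = e modulo d; so it carries
-- {Sum′ ≡ i} bijectively onto {Sum′ ≡ i + e}.
module ShiftBySums (d′ M : ℕ) where
  open Modulo d′
  n : ℕ
  n = M * D

  -- The map of [0,n) shifting block b by -l_b, and its inverse.
  shiftBack shiftFwd : List ℕ → ℕ → ℕ
  shiftBack l = blockMap d′ (λ b → shift d′ (d′ * coeff l b))
  shiftFwd  l = blockMap d′ (λ b → shift d′ (coeff l b))

  shiftBack-Perm : ∀ l → Perm n (shiftBack l)
  shiftBack-Perm l = blockMap-Perm d′ M _ _ (λ _ t _ → shift-< d′ _ t) (λ _ t _ → shift-< d′ _ t)
    (λ b → shift-inverseʳ d′ (coeff l b)) (λ b → shift-inverse d′ (coeff l b))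

  shiftBack-block : ∀ l x → x < n → quot (shiftBack l x) D ≡ quot x D
  shiftBack-block l x _ = blockMap-block d′ (λ b → shift d′ (d′ * coeff l b)) x (shift-< d′ (d′ * coeff l (x / D)) (x % D))

  shiftFwd-block : ∀ l x → x < n → quot (shiftFwd l x) D ≡ quot x D
  shiftFwd-block l x _ = blockMap-block d′ (λ b → shift d′ (coeff l b)) x (shift-< d′ (coeff l (x / D)) (x % D))

  shiftFwd-≈ : ∀ l x → shiftFwd l x ≈ x + coeff l (x / D)
  shiftFwd-≈ l x = begin
    ((x / D) * D + (x % D + c) % D) % D            ≡⟨ %-distribˡ-+ ((x / D) * D) ((x % D + c) % D) D ⟩
    ((x / D) * D % D + (x % D + c) % D % D) % D    ≡⟨ cong (λ z → ((x / D) * D % D + z) % D) (m%n%n≡m%n (x % D + c) D) ⟩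
    ((x / D) * D % D + (x % D + c) % D) % D        ≡⟨ sym (%-distribˡ-+ ((x / D) * D) (x % D + c) D) ⟩
    ((x / D) * D + (x % D + c)) % D                ≡⟨ cong (_% D) (trans (sym (+-assoc _ (x % D) c)) (cong (_+ c) (sym (div-mod-eq d′ x)))) ⟩
    (x + c) % D                                    ∎
    where
    open ≡-Reasoning
    c = coeff l (x / D)

  coeffs : Subset n → List ℕ
  coeffs A = bézout (blockCounts D A)

  F F⁻¹ : Subset n → Subset n
  F   A = pullback (shiftBack (coeffs A)) A
  F⁻¹ B = pullback (shiftFwd (coeffs B)) B

  coeffs-pullback : ∀ {π} → Perm n π → (∀ x → x < n → quot (π x) D ≡ quot x D) → ∀ A → coeffs (pullback π A) ≡ coeffs A
  coeffs-pullback {π} P inBlock A = cong bézout (blockCounts-cong D {pullback π A} {A} (λ j _ → blockSum-pullback P D inBlock A j))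

  F⁻¹∘F : ∀ A → F⁻¹ (F A) ≡ A
  F⁻¹∘F A rewrite coeffs-pullback (shiftBack-Perm (coeffs A)) (shiftBack-block (coeffs A)) A =
    pullback-inverse (shiftBack-Perm (coeffs A)) A

  F∘F⁻¹ : ∀ B → F (F⁻¹ B) ≡ B
  F∘F⁻¹ B rewrite coeffs-pullback (Perm-inverse (shiftBack-Perm (coeffs B))) (shiftFwd-block (coeffs B)) B =
    pullback-inverse (Perm-inverse (shiftBack-Perm (coeffs B))) B

  coeff-sum : ∀ (A : Subset n) l → ∑ n (λ x → χ A x * coeff l (x / D)) ≡ lin l (blockCounts D A)
  coeff-sum A l = begin
    ∑ n (λ x → χ A x * coeff l (x / D))                              ≡⟨ ∑-cong n (λ x x<n → cong (χ A x *_)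
                                                                           (sym (∑-δ M (x / D) (coeff l) (m<n*o⇒m/o<n {x} {M} {D} x<n)))) ⟩
    ∑ n (λ x → χ A x * ∑ M (λ b → coeff l b * δ (x / D) b))          ≡⟨ ∑-cong n (λ x _ → sym (∑-*ˡ M (χ A x) _)) ⟩
    ∑ n (λ x → ∑ M (λ b → χ A x * (coeff l b * δ (x / D) b)))        ≡⟨ ∑-swap n M _ ⟩
    ∑ M (λ b → ∑ n (λ x → χ A x * (coeff l b * δ (x / D) b)))        ≡⟨ ∑-cong M (λ b _ → ∑-cong n (λ x _ → swap-factor (χ A x) (coeff l b) _)) ⟩
    ∑ M (λ b → ∑ n (λ x → coeff l b * (χ A x * δ (x / D) b)))        ≡⟨ ∑-cong M (λ b _ → trans (∑-*ˡ n (coeff l b) _)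
                                                                           (cong (coeff l b *_) (sym (blockCount≡blockSum D A b)))) ⟩
    ∑ M (λ b → coeff l b * blockCount D A b)                         ≡⟨ cong (λ m → ∑ m (λ b → coeff l b * blockCount D A b)) (sym (m*n/n≡m M D)) ⟩
    ∑ (quot n D) (λ b → coeff l b * blockCount D A b)                ≡⟨ sym (lin-∑ (quot n D) l (blockCount D A) (λ x → x)) ⟩
    lin l (blockCounts D A)                                          ∎
    where
    open ≡-Reasoning
    swap-factor : ∀ a b c → a * (b * c) ≡ b * (a * c)
    swap-factor = solve-∀

  elemSum-F : ∀ A → elemSum (F A) ≈ elemSum A + gcdBlocks D A
  elemSum-F A = begin
    elemSum (F A) % D                                              ≡⟨ cong (_% D) (elemSum-pullback (shiftBack-Perm l) A) ⟩
    ∑ n (λ x → χ A x * shiftFwd l x) % D                           ≡⟨ ∑-≈ n _ _ (λ x _ → ≈-*ˡ (χ A x) _ _ (shiftFwd-≈ l x)) ⟩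
    ∑ n (λ x → χ A x * (x + coeff l (x / D))) % D                  ≡⟨ cong (_% D) (trans (∑-cong n (λ x _ → *-distribˡ-+ (χ A x) x _))
                                                                          (∑-+ n (λ x → χ A x * x) _)) ⟩
    (elemSum A + ∑ n (λ x → χ A x * coeff l (x / D))) % D          ≡⟨ cong (λ z → (elemSum A + z) % D) (coeff-sum A l) ⟩
    (elemSum A + lin l (blockCounts D A)) % D                      ≡⟨ ≈-+ (elemSum A) (elemSum A) _ (gcdBlocks D A) refl (bézout-≈ (blockCounts D A)) ⟩
    (elemSum A + gcdBlocks D A) % D                                ∎
    where
    open ≡-Reasoning
    l = coeffs A

  Sum′≡ : ∀ k A → Sum′ k A ≡ elemSum A ∸ k C 2
  Sum′≡ k A = cong (_∸ k C 2) (elemSum-∑ {n} A)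

  k≤elemSum : ∀ k (A : Subset n) → ∣ A ∣ ≡ k → k C 2 ≤ elemSum A
  k≤elemSum k A ∣A∣ = subst (λ z → z C 2 ≤ elemSum A) (trans (sym (card-∑ A)) ∣A∣) (elemSum-lower-bound n (lookupℕ A))

  Sum′-F : ∀ k e (A : Subset n) → ∣ A ∣ ≡ k → gcdBlocks D A ≡ e → Sum′ k (F A) ≈ Sum′ k A + e
  Sum′-F k e A ∣A∣ gcd≡e = begin
    Sum′ k (F A) % D                        ≡⟨ cong (_% D) (Sum′≡ k (F A)) ⟩
    (elemSum (F A) ∸ k C 2) % D             ≡⟨ ∸-≈ (k C 2) _ _ _ (k≤elemSum k (F A) (trans (card-pullback (shiftBack-Perm (coeffs A)) A) ∣A∣))
                                                 (k≤elemSum k A ∣A∣) (elemSum-F A) ⟩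
    (elemSum A ∸ k C 2 + gcdBlocks D A) % D ≡⟨ cong₂ (λ u v → (u + v) % D) (sym (Sum′≡ k A)) gcd≡e ⟩
    (Sum′ k A + e) % D                      ∎
    where open ≡-Reasoning

  counts-shift-by-e : ∀ k e (G : Subset n → Set) (G? : ∀ A → Dec (G A))
    → (∀ A → G A → ∣ A ∣ ≡ k) → (∀ A → G A → gcdBlocks D A ≡ e) → BlockInvariant D G
    → ∀ i → length (filter (λ A → G? A ×-dec (rem (Sum′ k A) D ≟ rem i D)) (allSubsets n))
          ≡ length (filter (λ A → G? A ×-dec (rem (Sum′ k A) D ≟ rem (i + e) D)) (allSubsets n))
  counts-shift-by-e k e G G? card gcd≡e invariant i =
    count-bijection (allSubsets n) (allSubsets-unique n) (allSubsets-complete n) F F⁻¹ F⁻¹∘F F∘F⁻¹ _ _ to from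
    where
    to : ∀ A → G A × Sum′ k A ≈ i → G (F A) × Sum′ k (F A) ≈ i + e
    to A (gA , Sum≈i) = invariant (shiftBack-Perm (coeffs A)) (shiftBack-block (coeffs A)) A gA ,
      trans (Sum′-F k e A (card A gA) (gcd≡e A gA)) (≈-+ (Sum′ k A) i e e Sum≈i refl)
    from : ∀ A → G (F A) × Sum′ k (F A) ≈ i + e → G A × Sum′ k A ≈ i
    from A (gFA , SumF≈i+e) = gA , ≈-cancelʳ (Sum′ k A) i e (trans (sym (Sum′-F k e A (card A gA) (gcd≡e A gA))) SumF≈i+e)
      where
      gA : G A
      gA = subst G (F⁻¹∘F A) (invariant (Perm-inverse (shiftBack-Perm (coeffs (F A)))) (shiftFwd-block (coeffs (F A))) (F A) gFA)

Sum′-period : ∀ {n} k d e (G : Subset n → Set) (G? : ∀ A → Dec (G A)) → d ∣ n → 1 ≤ n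
  → (∀ A → G A → ∣ A ∣ ≡ k) → (∀ A → G A → gcdBlocks d A ≡ e) → BlockInvariant d G
  → ∀ i → length (filter (λ A → G? A ×-dec (rem (Sum′ k A) d ≟ rem i d)) (allSubsets n))
        ≡ length (filter (λ A → G? A ×-dec (rem (Sum′ k A) d ≟ rem (i + e) d)) (allSubsets n))
Sum′-period k d e G G? d∣n 1≤n with divisor-pos d∣n 1≤n | d∣n
... | s≤s _ | divides M refl = ShiftBySums.counts-shift-by-e (pred d) M k e G G?

lemma7p14 : (n k : ℕ) → 1 ≤ n → (r : ℕ) → 1 ≤ r → (es : ℕ → ℕ)
    → (∀ i → i < r → es i ∣ es (suc i)) → es r ≡ n → es (pred r) ≡ gcd n k
    → let e = es 0
          d = es 1
          GD = InGD {n} k r es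
      in
      -- (i)
      (Σ (Vec ℕ (quot n d) → Set) λ P
        → (∀ α → P α → sumV α ≡ k × gcdV d α ≡ e)
        × (∀ (A : Subset n) → InS k A → (GD A ⇔ (∃[ α ] (P α × InSα k d α A)))))
      -- (ii)
      × (∀ A → GD A → GD (rot d A) × GD (rot e A))
      -- (iii)
      × (Σ (ℕ → ℕ) λ φ → Σ (Subset n → Subset n) λ ψ → Σ (Subset n → Subset n) λ ψ′
        → (∀ a b → φ (a + b) ≡ φ a + φ b [mod e ])
        × (∀ a b → φ a ≡ φ b [mod e ] → a ≡ b [mod e ])
        × (∀ b → ∃[ a ] (φ a ≡ b [mod e ]))
        × (∀ A → GD A → GD (ψ A) × GD (ψ′ A) × ψ′ (ψ A) ≡ A × ψ (ψ′ A) ≡ A)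
        × (∀ m A → GD A → ψ (rotPow d (quot d e * m) A) ≡ rotPow e (φ m) (ψ A)))
      -- (iv)
      × (∀ A → GD A → quot d (orbitSize d A) ∣ e)
      -- (v)
      × (∀ i → countSum n k r es d i ≡ countSum n k r es d (i + e))
lemma7p14 n k 1≤n r 1≤r es es∣ es-r _ =
  (Occurs , occurs-composition , GD⇔occurs) ,
  GD-rot ,
  Ce′≅Ce GD e d e∣d d∣n 1≤n GD-blockInvariant ,
  (λ A gA → subst (quot d (orbitSize d A) ∣_) (GD-gcd A gA) (orbit∣gcdBlocks d A d∣n 1≤n)) ,
  Sum′-period k d e GD (InGD? k r es) d∣n 1≤n GD-card GD-gcd GD-blockInvariant
  where open DivisorChain n k r 1≤n 1≤r es es∣ es-r
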